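{- For every integer $n\geq 1$, the number of even involutions in $\mathfrak{I}_n(132)$ equals $\binom{n-1}{2\lfloor (n+1)/4\rfloor}$, and the number of odd involutions in $\mathfrak{I}_n(132)$ equals $\binom{n-1}{1+2\lfloor (n-2)/4\rfloor}$.
   Context: $\mathfrak{S}_n$ is the symmetric group on $\{1,\dots,n\}$, permutations written in one-line notation $\pi=\pi_1\pi_2\cdots\pi_n$. An involution is a permutation with $\pi=\pi^{ -1}$; $\mathfrak{I}_n$ is the set of involutions in $\mathfrak{S}_n$. A permutation $\pi$ contains a pattern $\tau\in\mathfrak{S}_k$ if some subsequence $\pi_{i_1}\cdots\pi_{i_k}$ ($i_1<\dots<i_k$) is order-isomorphic to $\tau$, and avoids $\tau$ otherwise; $\mathfrak{I}_n(132)$ is the set of involutions in $\mathfrak{I}_n$ avoiding $132$. An inversion of $\pi$ is a pair $i<j$ with $\pi_i>\pi_j$; $\pi$ is even (odd) if its number of inversions is even (odd). $\lfloor\cdot\rfloor$ is the floor function and $\binom{a}{b}=0$ if $b<0$ or $b>a$. -}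

module Defs where

open import Data.Nat using (ℕ; zero; suc; _+_; _*_; _∸_; _<_; _<?_; _/_; _%_)
open import Data.Nat.Combinatorics using (_C_)
open import Data.Fin using (Fin; toℕ)
open import Data.Fin.Properties using (_≟_)
open import Data.Vec using (Vec; []; _∷_; lookup)
open import Data.List using (List; []; _∷_; concatMap; map; filter; length; allFin)
open import Data.Product using (_×_; _,_)
open import Relation.Nullary using (¬_; Dec)
open import Relation.Binary.PropositionalEquality using (_≡_)
open import Relation.Unary using (Decidable)
open import Relation.Nullary.Decidable using (_×-dec_; ¬?; _→-dec_)
open import Data.Fin.Properties using (all?; any?)
import Data.Fin as F

-- A permutation of {1..n} in one-line notation: a word π = π₁…πₙ over Fin n
-- (Fin n = {0,…,n-1} stands for {1,…,n}) which is injective.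
Word : ℕ → Set
Word n = Vec (Fin n) n

words : (m n : ℕ) → List (Vec (Fin n) m)
words zero    n = [] ∷ []
words (suc m) n = concatMap (λ x → map (x ∷_) (words m n)) (allFin n)

IsPerm : ∀ {n} → Word n → Set
IsPerm {n} π = ∀ (i j : Fin n) → lookup π i ≡ lookup π j → i ≡ j

IsInvolution : ∀ {n} → Word n → Set
IsInvolution {n} π = ∀ (i : Fin n) → lookup π (lookup π i) ≡ i

Contains132 : ∀ {n} → Word n → Set
Contains132 {n} π =
  Data.Product.Σ (Fin n) λ i → Data.Product.Σ (Fin n) λ j → Data.Product.Σ (Fin n) λ k →
    (i F.< j) × (j F.< k) × (lookup π i F.< lookup π k) × (lookup π k F.< lookup π j)

Avoids132 : ∀ {n} → Word n → Set
Avoids132 π = ¬ Contains132 π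

inv : ∀ {n} → Word n → ℕ
inv {n} π = length (filter (λ (p : Fin n × Fin n) → let (i , j) = p in (i F.<? j) ×-dec (lookup π j F.<? lookup π i))
                           (concatMap (λ i → map (i ,_) (allFin n)) (allFin n)))

IsEven : ∀ {n} → Word n → Set
IsEven π = inv π % 2 ≡ 0

IsOdd : ∀ {n} → Word n → Set
IsOdd π = inv π % 2 ≡ 1

isPerm? : ∀ {n} → Decidable (IsPerm {n})
isPerm? π = all? λ i → all? λ j → (lookup π i ≟ lookup π j) →-dec (i ≟ j)

isInvolution? : ∀ {n} → Decidable (IsInvolution {n})
isInvolution? π = all? λ i → lookup π (lookup π i) ≟ i

contains132? : ∀ {n} → Decidable (Contains132 {n})
contains132? π = any? λ i → any? λ j → any? λ k →
  (i F.<? j) ×-dec (j F.<? k) ×-dec (lookup π i F.<? lookup π k) ×-dec (lookup π k F.<? lookup π j)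

avoids132? : ∀ {n} → Decidable (Avoids132 {n})
avoids132? π = ¬? (contains132? π)

isEven? : ∀ {n} → Decidable (IsEven {n})
isEven? π = inv π % 2 Data.Nat.≟ 0

isOdd? : ∀ {n} → Decidable (IsOdd {n})
isOdd? π = inv π % 2 Data.Nat.≟ 1

involutions132 : (n : ℕ) → List (Word n)
involutions132 n = filter (λ π → isPerm? π ×-dec isInvolution? π ×-dec avoids132? π) (words n n)

numEven : ℕ → ℕ
numEven n = length (filter isEven? (involutions132 n))

numOdd : ℕ → ℕ
numOdd n = length (filter isOdd? (involutions132 n))

-- A 132-avoiding involution of [0, n] either fixes n, and then it arises from one of [0, n) by
-- appending a fixed point, or it sends n to some k < n, and then it arises from one of [0, n) with
-- a fixed point by "pairing up": the largest fixed point q is dropped, the block between k = n - 1 - q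
-- and q moves one step to the right, and the two-cycle (k, n) is created. Both steps are invertible;
-- appending keeps the number of inversions and pairing up adds an odd number of them. Hence an
-- involution in 𝔍ₙ(132) with c two-cycles has the parity of c, and the number ballot n c of those
-- satisfies ballot n c + C(n, c - 1) = C(n, c) for 2c ≤ n. Summing over c of one parity gives an
-- alternating sum of binomial coefficients, which telescopes to C(n - 1, m) or C(n - 1, m - 1),
-- m = ⌊n / 2⌋, according to the parity of m; the four residues of n modulo 4 give the formulas.
module Submission where

open import Defs
open import Data.Bool as Bool using (Bool; true; false; not; if_then_else_)
open import Data.Bool.Properties using (not-involutive; not-¬)
open import Data.Empty using (⊥; ⊥-elim)
open import Data.Fin as F using (Fin; toℕ; fromℕ<)
open import Data.Fin.Properties using (injective⇒≤; toℕ-fromℕ<; toℕ-injective; toℕ<n)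
open import Data.List as List using (List; []; _∷_; _++_; map; filter; length; concatMap; allFin)
open import Data.List.Properties using (map-∘; map-++; length-++; length-map; filter-++; filter-all; filter-none)
open import Data.List.Membership.Propositional using (_∈_)
open import Data.List.Membership.Propositional.Properties
  using (∈-map⁺; ∈-map⁻; ∈-++⁻; ∈-++⁺ˡ; ∈-++⁺ʳ; ∈-concatMap⁺; ∈-allFin; ∈-filter⁺; ∈-filter⁻)
open import Data.List.Membership.Propositional.Properties.WithK using (unique∧set⇒bag)
open import Data.List.Relation.Binary.BagAndSetEquality using (∼bag⇒↭)
open import Data.List.Relation.Binary.Disjoint.Propositional using (Disjoint)
open import Data.List.Relation.Binary.Permutation.Propositional.Properties using (↭-length)
open import Data.List.Relation.Unary.All as All using (All; []; _∷_)
import Data.List.Relation.Unary.All.Properties as Allₚ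
open import Data.List.Relation.Unary.AllPairs using ([]; _∷_)
open import Data.List.Relation.Unary.Any using (Any; here; there)
open import Data.List.Relation.Unary.Unique.Propositional using (Unique)
import Data.List.Relation.Unary.Unique.Propositional.Properties as Uniqueₚ
open import Data.Nat
open import Data.Nat.Combinatorics using (_C_; nCk+nC[k+1]≡[n+1]C[k+1]; nCk≡nC[n∸k])
open import Data.Nat.DivMod
  using (_mod_; m≤n⇒m%n≡m; m%n<n; m≡m%n+[m/n]*n; +-distrib-/-∣ʳ; m*n/n≡m; m<n⇒m/n≡0; %-distribˡ-+; [m+kn]%n≡m%n)
open import Data.Nat.Divisibility using (n∣m*n)
open import Data.Nat.ListAction using (sum)
open import Data.Nat.ListAction.Properties using (sum-++)
open import Data.Nat.Properties
open import Data.Nat.Tactic.RingSolver using (solve-∀)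
open import Data.Product using (_×_; _,_; proj₁; proj₂; Σ)
open import Data.Sum using (_⊎_; inj₁; inj₂)
open import Data.Vec as Vec using (Vec; []; _∷_; lookup; head; toList)
open import Data.Vec.Properties using (lookup∘tabulate)
open import Function using (id; _∘_; _∘′_)
open import Function.Bundles using (_⇔_; mk⇔; Equivalence)
open import Relation.Binary.Definitions using (tri<; tri≈; tri>)
open import Relation.Binary.PropositionalEquality
open import Relation.Nullary using (Dec; yes; no; ¬_; does; _×-dec_; contradiction)
open import Relation.Nullary.Reflects using (ofʸ; ofⁿ)
open import Relation.Unary using (Pred; Decidable)
open import Algebra.Properties.CommutativeSemigroup +-commutativeSemigroup using (interchange)
open import Algebra.Properties.Monoid.Sum +-0-monoid using (sum-syntax; sum-cong-≗) renaming (sum to ∑)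

-- Ballot numbers and alternating binomial sums

-- ballot n c will count the involutions in 𝔍ₙ(132) with c two-cycles.
ballot : ℕ → ℕ → ℕ
ballot zero    zero    = 1
ballot zero    (suc c) = 0
ballot (suc n) zero    = ballot n zero
ballot (suc n) (suc c) = ballot n (suc c) + (if c + c <ᵇ n then ballot n c else 0)

infixl 6.5 _C⁻_

_C⁻_ : ℕ → ℕ → ℕ
n C⁻ zero  = 0
n C⁻ suc c = n C c

ballot-zero : ∀ n → ballot n 0 ≡ 1
ballot-zero zero    = refl
ballot-zero (suc n) = ballot-zero n

ballot-vanishes : ∀ n c → n < c + c → ballot n c ≡ 0
ballot-vanishes zero    (suc c) _ = refl
ballot-vanishes (suc n) (suc c) n<2c+2 with c + c <ᵇ n | <ᵇ-reflects-< (c + c) n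
... | true  | ofʸ c+c<n = contradiction c+c<n (≤⇒≯ (≤-pred (≤-pred (subst (suc n <_) (cong suc (+-suc c c)) n<2c+2))))
... | false | _         = trans (+-identityʳ _) (ballot-vanishes n (suc c) (<-trans (n<1+n n) n<2c+2))

C⁻-pascal : ∀ n c → suc n C⁻ suc c ≡ n C⁻ suc c + n C⁻ c
C⁻-pascal n zero    = refl
C⁻-pascal n (suc c) = trans (sym (nCk+nC[k+1]≡[n+1]C[k+1] n c)) (+-comm (n C c) (n C suc c))

C-symmetric : ∀ {n a b} → a + b ≡ n → n C a ≡ n C b
C-symmetric {a = a} {b} refl = trans (nCk≡nC[n∸k] (m≤m+n a b)) (cong ((a + b) C_) (m+n∸m≡n a b))

ballot+C⁻≡C : ∀ n c → c + c ≤ n → ballot n c + n C⁻ c ≡ n C c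
ballot+C⁻≡C n       zero    _ = cong (_+ 0) (ballot-zero n)
ballot+C⁻≡C (suc n) (suc c) 2c+2≤n+1 with c + c <ᵇ n | <ᵇ-reflects-< (c + c) n
... | false | ofⁿ c+c≮n = contradiction (≤-pred (subst (_≤ suc n) (cong suc (+-suc c c)) 2c+2≤n+1)) c+c≮n
... | true  | ofʸ c+c<n with suc c + suc c ≤? n
...   | yes 2c+2≤n = begin
  ballot n (suc c) + ballot n c + suc n C⁻ suc c        ≡⟨ cong (ballot n (suc c) + ballot n c +_) (C⁻-pascal n c) ⟩
  ballot n (suc c) + ballot n c + (n C⁻ suc c + n C⁻ c) ≡⟨ interchange (ballot n (suc c)) (ballot n c) (n C⁻ suc c) (n C⁻ c) ⟩
  (ballot n (suc c) + n C⁻ suc c) + (ballot n c + n C⁻ c)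
    ≡⟨ cong₂ _+_ (ballot+C⁻≡C n (suc c) 2c+2≤n) (ballot+C⁻≡C n c (<⇒≤ c+c<n)) ⟩
  n C suc c + n C c                                     ≡⟨ +-comm (n C suc c) (n C c) ⟩
  n C c + n C suc c                                     ≡⟨ nCk+nC[k+1]≡[n+1]C[k+1] n c ⟩
  suc n C suc c                                         ∎
  where open ≡-Reasoning
...   | no 2c+2≰n = begin
  ballot n (suc c) + ballot n c + suc n C⁻ suc c   ≡⟨ cong (ballot n (suc c) + ballot n c +_) (C⁻-pascal n c) ⟩
  ballot n (suc c) + ballot n c + (n C c + n C⁻ c)
    ≡⟨ cong (λ x → x + ballot n c + (n C c + n C⁻ c)) (ballot-vanishes n (suc c) (≰⇒> 2c+2≰n)) ⟩
  ballot n c + (n C c + n C⁻ c)                    ≡⟨ cong (ballot n c +_) (+-comm (n C c) (n C⁻ c)) ⟩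
  ballot n c + (n C⁻ c + n C c)                    ≡⟨ sym (+-assoc (ballot n c) (n C⁻ c) (n C c)) ⟩
  ballot n c + n C⁻ c + n C c                      ≡⟨ cong (_+ n C c) (ballot+C⁻≡C n c (<⇒≤ c+c<n)) ⟩
  n C c + n C c                                    ≡⟨ cong (n C c +_) (C-symmetric {a = c} {suc c} (trans (+-suc c c) (sym n≡2c+1))) ⟩
  n C c + n C suc c                                ≡⟨ nCk+nC[k+1]≡[n+1]C[k+1] n c ⟩
  suc n C suc c                                    ∎
  where
  open ≡-Reasoning
  n≡2c+1 : n ≡ suc (c + c)
  n≡2c+1 = ≤-antisym (≤-pred (subst (suc n ≤_) (cong suc (+-suc c c)) (≰⇒> 2c+2≰n))) c+c<n

evenᵇ : ℕ → Bool
evenᵇ zero    = true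
evenᵇ (suc n) = not (evenᵇ n)

ifSame : Bool → Bool → ℕ → ℕ
ifSame true  true  x = x
ifSame false false x = x
ifSame _     _     _ = 0

ifSame-refl : ∀ b x → ifSame b b x ≡ x
ifSame-refl true  x = refl
ifSame-refl false x = refl

ifSame-≢ : ∀ b e x → e ≢ b → ifSame b e x ≡ 0
ifSame-≢ true  true  x e≢b = contradiction refl e≢b
ifSame-≢ true  false x _   = refl
ifSame-≢ false true  x _   = refl
ifSame-≢ false false x e≢b = contradiction refl e≢b

ifSame-notʳ : ∀ b e x → ifSame b (not e) x ≡ ifSame (not b) e x
ifSame-notʳ true  true  x = refl
ifSame-notʳ true  false x = refl
ifSame-notʳ false true  x = refl
ifSame-notʳ false false x = refl

ifSame-zero : ∀ b e → ifSame b e 0 ≡ 0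
ifSame-zero true  true  = refl
ifSame-zero true  false = refl
ifSame-zero false true  = refl
ifSame-zero false false = refl

ifSame-+ : ∀ b e x y → ifSame b e (x + y) ≡ ifSame b e x + ifSame b e y
ifSame-+ true  true  x y = refl
ifSame-+ true  false x y = refl
ifSame-+ false true  x y = refl
ifSame-+ false false x y = refl

paritySum : Bool → (ℕ → ℕ) → ℕ → ℕ
paritySum b f zero    = 0
paritySum b f (suc m) = paritySum b f m + ifSame b (evenᵇ m) (f m)

paritySum-cong : ∀ b {f g} m → (∀ {c} → c < m → f c ≡ g c) → paritySum b f m ≡ paritySum b g m
paritySum-cong b zero    f≗g = refl
paritySum-cong b (suc m) f≗g =
  cong₂ _+_ (paritySum-cong b m (λ c<m → f≗g (m<n⇒m<1+n c<m))) (cong (ifSame b (evenᵇ m)) (f≗g (n<1+n m)))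

paritySum-+ : ∀ b f g m → paritySum b (λ c → f c + g c) m ≡ paritySum b f m + paritySum b g m
paritySum-+ b f g zero    = refl
paritySum-+ b f g (suc m) = begin
  paritySum b (λ c → f c + g c) m + ifSame b (evenᵇ m) (f m + g m)
    ≡⟨ cong₂ _+_ (paritySum-+ b f g m) (ifSame-+ b (evenᵇ m) (f m) (g m)) ⟩
  paritySum b f m + paritySum b g m + (ifSame b (evenᵇ m) (f m) + ifSame b (evenᵇ m) (g m))
    ≡⟨ interchange (paritySum b f m) (paritySum b g m) _ _ ⟩
  paritySum b f m + ifSame b (evenᵇ m) (f m) + (paritySum b g m + ifSame b (evenᵇ m) (g m)) ∎
  where open ≡-Reasoning

paritySum-vanishing : ∀ b f m j → (∀ {c} → m ≤ c → f c ≡ 0) → paritySum b f (j + m) ≡ paritySum b f m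
paritySum-vanishing b f m zero    f≥m≡0 = refl
paritySum-vanishing b f m (suc j) f≥m≡0 = begin
  paritySum b f (j + m) + ifSame b (evenᵇ (j + m)) (f (j + m))
    ≡⟨ cong₂ _+_ (paritySum-vanishing b f m j f≥m≡0) (cong (ifSame b (evenᵇ (j + m))) (f≥m≡0 (m≤n+m m j))) ⟩
  paritySum b f m + ifSame b (evenᵇ (j + m)) 0 ≡⟨ cong (paritySum b f m +_) (ifSame-zero b _) ⟩
  paritySum b f m + 0                          ≡⟨ +-identityʳ _ ⟩
  paritySum b f m                              ∎
  where open ≡-Reasoning

paritySum-C⁻ : ∀ n b m → paritySum b (n C⁻_) (suc m) ≡ paritySum (not b) (n C_) m
paritySum-C⁻ n b zero    = ifSame-zero b true
paritySum-C⁻ n b (suc m) =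
  cong₂ _+_ (paritySum-C⁻ n b m) (ifSame-notʳ b (evenᵇ m) (n C m))

-- The alternating sum of suc n C c over c ≤ t is ± n C t.
paritySum-pascal : ∀ n t →
  paritySum (evenᵇ t) (suc n C_) (suc t) ≡ n C t + paritySum (not (evenᵇ t)) (suc n C_) (suc t)
paritySum-pascal n zero    = refl
paritySum-pascal n (suc t) = begin
  P (not e) (suc t) + ifSame (not e) (not e) (suc n C suc t)
    ≡⟨ cong (P (not e) (suc t) +_) (trans (ifSame-refl (not e) _) (sym (nCk+nC[k+1]≡[n+1]C[k+1] n t))) ⟩
  P (not e) (suc t) + (n C t + n C suc t)
    ≡⟨ shuffle (P (not e) (suc t)) (n C t) (n C suc t) ⟩
  n C suc t + (n C t + P (not e) (suc t))
    ≡⟨ cong (n C suc t +_) (sym (paritySum-pascal n t)) ⟩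
  n C suc t + P e (suc t)
    ≡⟨ cong (n C suc t +_) (sym (trans (cong (P e (suc t) +_) (ifSame-≢ e (not e) _ (≢-sym (not-¬ refl)))) (+-identityʳ _))) ⟩
  n C suc t + (P e (suc t) + ifSame e (not e) (suc n C suc t))
    ≡⟨ cong (λ b → n C suc t + (P b (suc t) + ifSame b (not e) (suc n C suc t))) (sym (not-involutive e)) ⟩
  n C suc t + (P (not (not e)) (suc t) + ifSame (not (not e)) (not e) (suc n C suc t)) ∎
  where
  open ≡-Reasoning
  e : Bool
  e = evenᵇ t
  P : Bool → ℕ → ℕ
  P b = paritySum b (suc n C_)
  shuffle : ∀ a b c → a + (b + c) ≡ c + (b + a)
  shuffle = solve-∀

paritySum-ballot+C : ∀ n b m → m + m ≤ n →
  paritySum b (ballot n) (suc m) + paritySum (not b) (n C_) m ≡ paritySum b (n C_) (suc m)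
paritySum-ballot+C n b m 2m≤n = begin
  paritySum b (ballot n) (suc m) + paritySum (not b) (n C_) m
    ≡⟨ cong (paritySum b (ballot n) (suc m) +_) (sym (paritySum-C⁻ n b m)) ⟩
  paritySum b (ballot n) (suc m) + paritySum b (n C⁻_) (suc m)
    ≡⟨ sym (paritySum-+ b (ballot n) (n C⁻_) (suc m)) ⟩
  paritySum b (λ c → ballot n c + n C⁻ c) (suc m)
    ≡⟨ paritySum-cong b (suc m) (λ c≤m → ballot+C⁻≡C n _ (≤-trans (+-mono-≤ (≤-pred c≤m) (≤-pred c≤m)) 2m≤n)) ⟩
  paritySum b (n C_) (suc m) ∎
  where open ≡-Reasoning

-- The hypotheses say that m = ⌊n / 2⌋ for n = suc n′, so that ballot n c vanishes for c > m.
module BallotParitySums (n′ m : ℕ) (2m≤n : m + m ≤ suc n′) (n<2m+2 : suc n′ < suc m + suc m)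
                        {b : Bool} (m-parity : evenᵇ m ≡ b) where

  private
    n : ℕ
    n = suc n′
    e : Bool
    e = evenᵇ m
    P : Bool → ℕ → ℕ
    P b = paritySum b (n C_)

  truncate : ∀ b → paritySum b (ballot n) (suc n) ≡ paritySum b (ballot n) (suc m)
  truncate b = trans (cong (paritySum b (ballot n)) n+1≡[n∸m]+m+1)
    (paritySum-vanishing b (ballot n) (suc m) (n ∸ m) (λ {c} m<c → ballot-vanishes n c (<-≤-trans n<2m+2 (+-mono-≤ m<c m<c))))
    where
    n+1≡[n∸m]+m+1 : suc n ≡ (n ∸ m) + suc m
    n+1≡[n∸m]+m+1 = trans (cong suc (sym (m∸n+n≡m (≤-trans (m≤m+n m m) 2m≤n)))) (sym (+-suc (n ∸ m) m))

  same-parity : paritySum b (ballot n) (suc n) ≡ n′ C m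
  same-parity = subst (λ b → paritySum b (ballot n) (suc n) ≡ n′ C m) m-parity (+-cancelʳ-≡ (P (not e) m) _ _ (begin
    paritySum e (ballot n) (suc n) + P (not e) m   ≡⟨ cong (_+ P (not e) m) (truncate e) ⟩
    paritySum e (ballot n) (suc m) + P (not e) m   ≡⟨ paritySum-ballot+C n e m 2m≤n ⟩
    P e (suc m)                                    ≡⟨ paritySum-pascal n′ m ⟩
    n′ C m + (P (not e) m + ifSame (not e) e (n C m)) ≡⟨ cong (λ x → n′ C m + (P (not e) m + x)) (ifSame-≢ (not e) e _ (not-¬ refl)) ⟩
    n′ C m + (P (not e) m + 0)                     ≡⟨ cong (n′ C m +_) (+-identityʳ _) ⟩
    n′ C m + P (not e) m                           ∎))
    where open ≡-Reasoning

  other-parity : paritySum (not b) (ballot n) (suc n) ≡ n′ C⁻ m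
  other-parity = subst (λ b → paritySum (not b) (ballot n) (suc n) ≡ n′ C⁻ m) m-parity (cancel-telescope m (begin
    paritySum (not e) (ballot n) (suc n) + P e m          ≡⟨ cong (_+ P e m) (truncate (not e)) ⟩
    paritySum (not e) (ballot n) (suc m) + P e m          ≡⟨ cong (λ b → paritySum (not e) (ballot n) (suc m) + P b m) (sym (not-involutive e)) ⟩
    paritySum (not e) (ballot n) (suc m) + P (not (not e)) m ≡⟨ paritySum-ballot+C n (not e) m 2m≤n ⟩
    P (not e) m + ifSame (not e) e (n C m)                ≡⟨ cong (P (not e) m +_) (ifSame-≢ (not e) e _ (not-¬ refl)) ⟩
    P (not e) m + 0                                       ≡⟨ +-identityʳ _ ⟩
    P (not e) m                                           ∎))
    where
    open ≡-Reasoning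
    cancel-telescope : ∀ t {x} → x + P (evenᵇ t) t ≡ P (not (evenᵇ t)) t → x ≡ n′ C⁻ t
    cancel-telescope zero    x+0≡0 = trans (sym (+-identityʳ _)) x+0≡0
    cancel-telescope (suc t) {x} x+P≡P = +-cancelʳ-≡ (P (not (evenᵇ t)) (suc t)) x (n′ C t) (begin
      x + P (not (evenᵇ t)) (suc t)       ≡⟨ x+P≡P ⟩
      P (not (not (evenᵇ t))) (suc t)     ≡⟨ cong (λ b → P b (suc t)) (not-involutive (evenᵇ t)) ⟩
      P (evenᵇ t) (suc t)                 ≡⟨ paritySum-pascal n′ t ⟩
      n′ C t + P (not (evenᵇ t)) (suc t)  ∎)

evenᵇ-double : ∀ q → evenᵇ (q * 2) ≡ true
evenᵇ-double zero    = refl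
evenᵇ-double (suc q) = cong (λ b → not (not b)) (evenᵇ-double q)

[r+q*4]/4≡q : ∀ r q → r < 4 → (r + q * 4) / 4 ≡ q
[r+q*4]/4≡q r q r<4 = trans (+-distrib-/-∣ʳ r (n∣m*n q)) (cong₂ _+_ (m<n⇒m/n≡0 r<4) (m*n/n≡m q 4))

[r+q*4+1]/4≡q : ∀ r q → suc r < 4 → (r + q * 4 + 1) / 4 ≡ q
[r+q*4+1]/4≡q r q r+1<4 = trans (cong (_/ 4) (+-comm (r + q * 4) 1)) ([r+q*4]/4≡q (suc r) q r+1<4)

BallotParityFormula : ℕ → Set
BallotParityFormula n =
  (paritySum true  (ballot n) (suc n) ≡ (n ∸ 1) C (2 * ((n + 1) / 4))) ×
  (paritySum false (ballot n) (suc n) ≡ (n ∸ 1) C (1 + 2 * ((n ∸ 2) / 4)))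

private
  4q≡2q+2q : ∀ q → q * 4 ≡ q * 2 + q * 2
  4q≡2q+2q = solve-∀

  4q+2≡[2q+1]+[2q+1] : ∀ q → 2 + q * 4 ≡ suc (q * 2) + suc (q * 2)
  4q+2≡[2q+1]+[2q+1] = solve-∀

  2q+[2q+2]≡4q+2 : ∀ q → q * 2 + (2 + q * 2) ≡ 2 + q * 4
  2q+[2q+2]≡4q+2 = solve-∀

  module OddSize  {n′ m} (n′≡2m : n′ ≡ m + m) =
    BallotParitySums n′ m (m≤n⇒m≤1+n (≤-reflexive (sym n′≡2m))) (s≤s (≤-reflexive (trans (cong suc n′≡2m) (sym (+-suc m m)))))
  module EvenSize {n′ m} (n≡2m : suc n′ ≡ m + m) =
    BallotParitySums n′ m (≤-reflexive (sym n≡2m)) (s≤s (≤-trans (≤-reflexive n≡2m) (≤-trans (n≤1+n _) (≤-reflexive (sym (+-suc m m))))))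

module _ (q : ℕ) where

  private
    2q≡q2 : 2 * q ≡ q * 2
    2q≡q2 = *-comm 2 q
    evenᵇ-2q : evenᵇ (q * 2) ≡ true
    evenᵇ-2q = evenᵇ-double q

  ballot-parity-4q+1 : BallotParityFormula (1 + q * 4)
  ballot-parity-4q+1 =
    trans same-parity (cong ((q * 4) C_) (sym even-index)) ,
    trans other-parity (odd-index q)
    where
    open OddSize {q * 4} {q * 2} (4q≡2q+2q q) evenᵇ-2q
    even-index : 2 * ((1 + q * 4 + 1) / 4) ≡ q * 2
    even-index = trans (cong (2 *_) ([r+q*4+1]/4≡q 1 q (s<s (s<s z<s)))) 2q≡q2
    odd-index : ∀ q → q * 4 C⁻ (q * 2) ≡ q * 4 C (1 + 2 * ((1 + q * 4 ∸ 2) / 4))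
    odd-index zero    = refl
    odd-index (suc p) = cong (λ x → suc p * 4 C suc x) (trans (sym (*-comm 2 p)) (cong (2 *_) (sym ([r+q*4]/4≡q 3 p ≤-refl))))

  ballot-parity-4q+2 : BallotParityFormula (2 + q * 4)
  ballot-parity-4q+2 =
    trans other-parity (cong ((1 + q * 4) C_) (sym even-index)) ,
    trans same-parity (cong ((1 + q * 4) C_) (sym odd-index))
    where
    open EvenSize {1 + q * 4} {suc (q * 2)} (4q+2≡[2q+1]+[2q+1] q) (cong not evenᵇ-2q)
    even-index : 2 * ((2 + q * 4 + 1) / 4) ≡ q * 2
    even-index = trans (cong (2 *_) ([r+q*4+1]/4≡q 2 q ≤-refl)) 2q≡q2
    odd-index : 1 + 2 * ((q * 4) / 4) ≡ suc (q * 2)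
    odd-index = cong suc (trans (cong (2 *_) (m*n/n≡m q 4)) 2q≡q2)

  ballot-parity-4q+3 : BallotParityFormula (3 + q * 4)
  ballot-parity-4q+3 =
    trans other-parity
          (trans (C-symmetric {a = q * 2} {2 + q * 2} (2q+[2q+2]≡4q+2 q)) (cong ((2 + q * 4) C_) (sym even-index))) ,
    trans same-parity (cong ((2 + q * 4) C_) (sym odd-index))
    where
    open OddSize {2 + q * 4} {suc (q * 2)} (4q+2≡[2q+1]+[2q+1] q) (cong not evenᵇ-2q)
    even-index : 2 * ((3 + q * 4 + 1) / 4) ≡ 2 + q * 2
    even-index = trans (cong (λ x → 2 * (x / 4)) (+-comm (3 + q * 4) 1)) (trans (cong (2 *_) (m*n/n≡m (suc q) 4)) (*-comm 2 (suc q)))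
    odd-index : 1 + 2 * ((1 + q * 4) / 4) ≡ suc (q * 2)
    odd-index = cong suc (trans (cong (2 *_) ([r+q*4]/4≡q 1 q (s<s z<s))) 2q≡q2)

  ballot-parity-4q+4 : BallotParityFormula (4 + q * 4)
  ballot-parity-4q+4 =
    trans same-parity (cong ((3 + q * 4) C_) (sym even-index)) ,
    trans other-parity (cong ((3 + q * 4) C_) (sym odd-index))
    where
    open EvenSize {3 + q * 4} {suc q * 2} (4q≡2q+2q (suc q)) (evenᵇ-double (suc q))
    even-index : 2 * ((4 + q * 4 + 1) / 4) ≡ suc q * 2
    even-index = trans (cong (2 *_) ([r+q*4+1]/4≡q 0 (suc q) (s<s z<s))) (*-comm 2 (suc q))
    odd-index : 1 + 2 * ((2 + q * 4) / 4) ≡ suc (q * 2)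
    odd-index = cong suc (trans (cong (2 *_) ([r+q*4]/4≡q 2 q (s<s (s<s z<s)))) 2q≡q2)

ballot-parity-formula : ∀ n → 1 ≤ n → BallotParityFormula n
ballot-parity-formula (suc n′) _ = by-residue (n′ % 4) (m%n<n n′ 4) (m≡m%n+[m/n]*n n′ 4)
  where
  by-residue : ∀ r → r < 4 → n′ ≡ r + (n′ / 4) * 4 → BallotParityFormula (suc n′)
  by-residue 0 _ n′≡ = subst (BallotParityFormula ∘ suc) (sym n′≡) (ballot-parity-4q+1 (n′ / 4))
  by-residue 1 _ n′≡ = subst (BallotParityFormula ∘ suc) (sym n′≡) (ballot-parity-4q+2 (n′ / 4))
  by-residue 2 _ n′≡ = subst (BallotParityFormula ∘ suc) (sym n′≡) (ballot-parity-4q+3 (n′ / 4))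
  by-residue 3 _ n′≡ = subst (BallotParityFormula ∘ suc) (sym n′≡) (ballot-parity-4q+4 (n′ / 4))
  by-residue (suc (suc (suc (suc _)))) (s≤s (s≤s (s≤s (s≤s ())))) _

-- Words as functions on ℕ

-- junk value 0 beyond the length of the word
at : ∀ {a m} → Vec (Fin a) m → ℕ → ℕ
at []      _       = 0
at (x ∷ _) zero    = toℕ x
at (_ ∷ v) (suc i) = at v i

at-toℕ : ∀ {a m} (v : Vec (Fin a) m) (i : Fin m) → at v (toℕ i) ≡ toℕ (lookup v i)
at-toℕ (x ∷ v) F.zero    = refl
at-toℕ (x ∷ v) (F.suc i) = at-toℕ v i

at-fromℕ< : ∀ {a m} (v : Vec (Fin a) m) {i} (i<m : i < m) → at v i ≡ toℕ (lookup v (fromℕ< i<m))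
at-fromℕ< v i<m = trans (cong (at v) (sym (toℕ-fromℕ< i<m))) (at-toℕ v (fromℕ< i<m))

at-bounded : ∀ {a m} (v : Vec (Fin a) m) i → i < m → at v i < a
at-bounded (x ∷ v) zero    _         = toℕ<n x
at-bounded (x ∷ v) (suc i) (s≤s i<m) = at-bounded v i i<m

at-injective : ∀ {a m} (v w : Vec (Fin a) m) → (∀ i → i < m → at v i ≡ at w i) → v ≡ w
at-injective []      []      _      = refl
at-injective (x ∷ v) (y ∷ w) v≗w =
  cong₂ _∷_ (toℕ-injective (v≗w 0 (s≤s z≤n))) (at-injective v w (λ i i<m → v≗w (suc i) (s≤s i<m)))

-- values are taken modulo n only to make fromFunction total
fromFunction : (n : ℕ) → (ℕ → ℕ) → Word n
fromFunction zero    f = []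
fromFunction (suc n) f = Vec.tabulate (λ i → f (toℕ i) mod suc n)

at-fromFunction : ∀ n f i → i < n → f i < n → at (fromFunction n f) i ≡ f i
at-fromFunction (suc n) f i i<n fi<n = begin
  at (fromFunction (suc n) f) i                ≡⟨ at-fromℕ< (fromFunction (suc n) f) i<n ⟩
  toℕ (lookup (fromFunction (suc n) f) j)      ≡⟨ cong toℕ (lookup∘tabulate (λ i → f (toℕ i) mod suc n) j) ⟩
  toℕ (f (toℕ j) mod suc n)                    ≡⟨ toℕ-fromℕ< _ ⟩
  f (toℕ j) % suc n                            ≡⟨ cong (λ x → f x % suc n) (toℕ-fromℕ< i<n) ⟩
  f i % suc n                                  ≡⟨ m≤n⇒m%n≡m (≤-pred fi<n) ⟩
  f i                                          ∎
  where
  open ≡-Reasoning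
  j : Fin (suc n)
  j = fromℕ< i<n

Avoids132On : ℕ → (ℕ → ℕ) → Set
Avoids132On n f = ∀ i j k → i < j → j < k → k < n → f i < f k → f k < f j → ⊥

record Involution132 (n : ℕ) (f : ℕ → ℕ) : Set where
  field
    bounded    : ∀ i → i < n → f i < n
    involutive : ∀ i → i < n → f (f i) ≡ i
    avoids132  : Avoids132On n f

  injective : ∀ i j → i < n → j < n → f i ≡ f j → i ≡ j
  injective i j i<n j<n fi≡fj = trans (sym (involutive i i<n)) (trans (cong f fi≡fj) (involutive j j<n))

Involution132-cong : ∀ {m f g} → (∀ i → i < m → f i ≡ g i) → Involution132 m f → Involution132 m g
Involution132-cong {m} {f} {g} f≗g I = record
  { bounded    = λ i i<m → subst (_< m) (f≗g i i<m) (bounded i i<m)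
  ; involutive = λ i i<m → trans (cong g (sym (f≗g i i<m))) (trans (sym (f≗g (f i) (bounded i i<m))) (involutive i i<m))
  ; avoids132  = λ i j k i<j j<k k<m fi<fk fk<fj →
      avoids132 i j k i<j j<k k<m
        (subst₂ _<_ (sym (f≗g i (<-trans i<j (<-trans j<k k<m)))) (sym (f≗g k k<m)) fi<fk)
        (subst₂ _<_ (sym (f≗g k k<m)) (sym (f≗g j (<-trans j<k k<m))) fk<fj)
  }
  where open Involution132 I

-- exactly the filter of involutions132; IsPerm is redundant given IsInvolution
Is132AvoidingInvolution : ∀ {n} → Word n → Set
Is132AvoidingInvolution π = IsPerm π × (IsInvolution π × Avoids132 π)

is132AvoidingInvolution? : ∀ {n} (π : Word n) → Dec (Is132AvoidingInvolution π)
is132AvoidingInvolution? π = isPerm? π ×-dec isInvolution? π ×-dec avoids132? π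

word⇒Involution132 : ∀ {n} (w : Word n) → Is132AvoidingInvolution w → Involution132 n (at w)
word⇒Involution132 {n} w (_ , involution , avoids) = record
  { bounded    = at-bounded w
  ; involutive = involutive
  ; avoids132  = avoids132
  }
  where
  involutive : ∀ i → i < n → at w (at w i) ≡ i
  involutive i i<n = begin
    at w (at w i)                ≡⟨ cong (at w) (at-fromℕ< w i<n) ⟩
    at w (toℕ (lookup w j))      ≡⟨ at-toℕ w (lookup w j) ⟩
    toℕ (lookup w (lookup w j))  ≡⟨ cong toℕ (involution j) ⟩
    toℕ j                        ≡⟨ toℕ-fromℕ< i<n ⟩
    i                            ∎
    where
    open ≡-Reasoning
    j : Fin n
    j = fromℕ< i<n
  avoids132 : Avoids132On n (at w)
  avoids132 i j k i<j j<k k<n wi<wk wk<wj =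
    avoids (fromℕ< i<n , fromℕ< j<n , fromℕ< k<n ,
            subst₂ _<_ (sym (toℕ-fromℕ< i<n)) (sym (toℕ-fromℕ< j<n)) i<j ,
            subst₂ _<_ (sym (toℕ-fromℕ< j<n)) (sym (toℕ-fromℕ< k<n)) j<k ,
            subst₂ _<_ (at-fromℕ< w i<n) (at-fromℕ< w k<n) wi<wk ,
            subst₂ _<_ (at-fromℕ< w k<n) (at-fromℕ< w j<n) wk<wj)
    where
    j<n : j < n
    j<n = <-trans j<k k<n
    i<n : i < n
    i<n = <-trans i<j j<n

Involution132⇒word : ∀ {n} (w : Word n) → Involution132 n (at w) → Is132AvoidingInvolution w
Involution132⇒word w I = perm , involution , avoids
  where
  open Involution132 I
  involution : IsInvolution w
  involution i = toℕ-injective (begin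
    toℕ (lookup w (lookup w i)) ≡⟨ sym (at-toℕ w (lookup w i)) ⟩
    at w (toℕ (lookup w i))     ≡⟨ cong (at w) (sym (at-toℕ w i)) ⟩
    at w (at w (toℕ i))         ≡⟨ involutive (toℕ i) (toℕ<n i) ⟩
    toℕ i                       ∎)
    where open ≡-Reasoning
  perm : IsPerm w
  perm i j wi≡wj = trans (sym (involution i)) (trans (cong (lookup w) wi≡wj) (involution j))
  avoids : Avoids132 w
  avoids (i , j , k , i<j , j<k , wi<wk , wk<wj) =
    avoids132 (toℕ i) (toℕ j) (toℕ k) i<j j<k (toℕ<n k)
      (subst₂ _<_ (sym (at-toℕ w i)) (sym (at-toℕ w k)) wi<wk)
      (subst₂ _<_ (sym (at-toℕ w k)) (sym (at-toℕ w j)) wk<wj)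

at-fromFunction-Involution132 : ∀ {n f} → Involution132 n f → ∀ i → i < n → at (fromFunction n f) i ≡ f i
at-fromFunction-Involution132 {n} {f} I i i<n = at-fromFunction n f i i<n (Involution132.bounded I i i<n)

fromFunction-Involution132 : ∀ {n f} → Involution132 n f → Involution132 n (at (fromFunction n f))
fromFunction-Involution132 I = Involution132-cong (λ i i<n → sym (at-fromFunction-Involution132 I i i<n)) I

fromFunction-132AvoidingInvolution : ∀ {n f} → Involution132 n f → Is132AvoidingInvolution (fromFunction n f)
fromFunction-132AvoidingInvolution {n} {f} I = Involution132⇒word (fromFunction n f) (fromFunction-Involution132 I)

∈-words : ∀ m n (v : Vec (Fin n) m) → v ∈ words m n
∈-words zero    n []      = here refl
∈-words (suc m) n (x ∷ v) = ∈-concatMap⁺ (λ y → map (y ∷_) (words m n)) (∈-extensions (allFin n) (∈-allFin x))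
  where
  ∈-extensions : ∀ ys → x ∈ ys → Any (λ y → x ∷ v ∈ map (y ∷_) (words m n)) ys
  ∈-extensions (y ∷ ys) (here refl) = here (∈-map⁺ (x ∷_) (∈-words m n v))
  ∈-extensions (y ∷ ys) (there x∈ys) = there (∈-extensions ys x∈ys)

words-unique : ∀ m n → Unique (words m n)
words-unique zero    n = [] ∷ []
words-unique (suc m) n = extensions-unique (allFin n) (Uniqueₚ.allFin⁺ n)
  where
  extensions : List (Fin n) → List (Vec (Fin n) (suc m))
  extensions = concatMap (λ y → map (y ∷_) (words m n))
  head-∈ : ∀ ys {v} → v ∈ extensions ys → head v ∈ ys
  head-∈ (y ∷ ys) v∈ with ∈-++⁻ (map (y ∷_) (words m n)) v∈
  ... | inj₁ v∈y∷ with ∈-map⁻ (y ∷_) v∈y∷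
  ...   | _ , _ , refl = here refl
  head-∈ (y ∷ ys) v∈ | inj₂ v∈ys = there (head-∈ ys v∈ys)
  extensions-unique : ∀ ys → Unique ys → Unique (extensions ys)
  extensions-unique []       _              = []
  extensions-unique (y ∷ ys) (y∉ys ∷ uniq) =
    Uniqueₚ.++⁺ (Uniqueₚ.map⁺ ∷-injectiveʳ (words-unique m n)) (extensions-unique ys uniq) disjoint
    where
    ∷-injectiveʳ : ∀ {v w : Vec (Fin n) m} → y ∷ v ≡ y ∷ w → v ≡ w
    ∷-injectiveʳ refl = refl
    disjoint : Disjoint (map (y ∷_) (words m n)) (extensions ys)
    disjoint (v∈y∷ , v∈ys) with ∈-map⁻ (y ∷_) v∈y∷
    ... | _ , _ , refl = All.lookup y∉ys (head-∈ ys v∈ys) refl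

-- Structure of 132-avoiding involutions

injection⇒≤ : ∀ {m r} (g : ℕ → ℕ) → (∀ i → i < m → g i < r) → (∀ i j → i < m → j < m → g i ≡ g j → i ≡ j) → m ≤ r
injection⇒≤ {m} {r} g g<r g-injective = injective⇒≤ {f = G} G-injective
  where
  G : Fin m → Fin r
  G i = fromℕ< (g<r (toℕ i) (toℕ<n i))
  G-injective : ∀ {i j} → G i ≡ G j → i ≡ j
  G-injective {i} {j} Gi≡Gj = toℕ-injective (g-injective (toℕ i) (toℕ j) (toℕ<n i) (toℕ<n j)
    (trans (sym (toℕ-fromℕ< _)) (trans (cong toℕ Gi≡Gj) (toℕ-fromℕ< _))))

interval-injection⇒≤ : ∀ {n} {f : ℕ → ℕ} → (∀ i j → i < n → j < n → f i ≡ f j → i ≡ j) → ∀ a m lo r → a + m ≤ n →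
  (∀ i → a ≤ i → i < a + m → lo ≤ f i × f i < lo + r) → m ≤ r
interval-injection⇒≤ {n} {f} injective a m lo r a+m≤n maps-into = injection⇒≤ g g<r g-injective
  where
  g : ℕ → ℕ
  g i = f (a + i) ∸ lo
  in-range : ∀ {i} → i < m → lo ≤ f (a + i) × f (a + i) < lo + r
  in-range i<m = maps-into _ (m≤m+n _ _) (+-monoʳ-< a i<m)
  g<r : ∀ i → i < m → g i < r
  g<r i i<m = +-cancelˡ-< lo _ r (subst (_< lo + r) (sym (m+[n∸m]≡n (proj₁ (in-range i<m)))) (proj₂ (in-range i<m)))
  g-injective : ∀ i j → i < m → j < m → g i ≡ g j → i ≡ j
  g-injective i j i<m j<m gi≡gj = +-cancelˡ-≡ a i j (injective (a + i) (a + j)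
    (<-≤-trans (+-monoʳ-< a i<m) a+m≤n) (<-≤-trans (+-monoʳ-< a j<m) a+m≤n)
    (trans (sym (m+[n∸m]≡n (proj₁ (in-range i<m)))) (trans (cong (lo +_) gi≡gj) (m+[n∸m]≡n (proj₁ (in-range j<m))))))

record IsMaxFixedPoint (n : ℕ) (f : ℕ → ℕ) (q : ℕ) : Set where
  field
    q<n   : q < n
    fixed : f q ≡ q
    last  : ∀ i → q < i → i < n → f i ≢ i

-- Around its largest fixed point q a 132-avoiding involution of [0, n) splits into blocks
-- [0, k) [k, q) {q} (q, n) with k = n - 1 - q: the outer blocks are swapped, the middle one is kept.
module MaxFixedPoint {n f} (I : Involution132 n f) {q} (M : IsMaxFixedPoint n f q) where

  open Involution132 I
  open IsMaxFixedPoint M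

  k : ℕ
  k = n ∸ suc q

  q+1+k≡n : suc q + k ≡ n
  q+1+k≡n = m+[n∸m]≡n q<n

  private
    ≢q : ∀ {i} → i < n → i ≢ q → f i ≢ q
    ≢q i<n i≢q fi≡q = i≢q (injective _ q i<n q<n (trans fi≡q (sym fixed)))

  after-q→below-q : ∀ j → q < j → j < n → f j < q
  after-q→below-q j q<j j<n with <-cmp (f j) q
  ... | tri< fj<q _ _ = fj<q
  ... | tri≈ _ fj≡q _ = ⊥-elim (≢q j<n (λ j≡q → <⇒≢ q<j (sym j≡q)) fj≡q)
  ... | tri> _ _ q<fj with <-cmp j (f j)
  ...   | tri< j<fj _ _ = ⊥-elim (avoids132 q j (f j) q<j j<fj (bounded j j<n)
                            (subst₂ _<_ (sym fixed) (sym (involutive j j<n)) q<j) (subst (_< f j) (sym (involutive j j<n)) j<fj))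
  ...   | tri≈ _ j≡fj _ = ⊥-elim (last j q<j j<n (sym j≡fj))
  ...   | tri> _ _ fj<j = ⊥-elim (avoids132 q (f j) j q<fj fj<j j<n
                            (subst (_< f j) (sym fixed) q<fj) (subst (f j <_) (sym (involutive j j<n)) fj<j))

  above-q-leftward : ∀ i i′ → i′ < i → i < q → q < f i → q < f i′
  above-q-leftward i i′ i′<i i<q q<fi with <-cmp (f i′) q
  ... | tri< fi′<q _ _ = ⊥-elim (avoids132 i′ i q i′<i i<q q<n (subst (f i′ <_) (sym fixed) fi′<q) (subst (_< f i) (sym fixed) q<fi))
  ... | tri≈ _ fi′≡q _ = ⊥-elim (≢q (<-trans (<-trans i′<i i<q) q<n) (<⇒≢ (<-trans i′<i i<q)) fi′≡q)
  ... | tri> _ _ q<fi′ = q<fi′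

  k≤q : k ≤ q
  k≤q = interval-injection⇒≤ injective (suc q) k 0 q (≤-reflexive q+1+k≡n)
          (λ j q<j j<n → z≤n , after-q→below-q j q<j (subst (j <_) q+1+k≡n j<n))

  head→tail : ∀ i → i < k → q < f i
  head→tail i i<k with <-cmp q (f i)
  ... | tri< q<fi _ _ = q<fi
  ... | tri≈ _ q≡fi _ = ⊥-elim (≢q (<-trans i<q q<n) (<⇒≢ i<q) (sym q≡fi))
    where
    i<q : i < q
    i<q = <-≤-trans i<k k≤q
  ... | tri> _ _ fi<q = ⊥-elim (<⇒≱ i<k (interval-injection⇒≤ injective (suc q) k 0 i (≤-reflexive q+1+k≡n)
                          (λ v q<v v<n → z≤n , below-i v q<v (subst (v <_) q+1+k≡n v<n))))
    where
    below-i : ∀ v → q < v → v < n → f v < i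
    below-i v q<v v<n with <-cmp (f v) i
    ... | tri< fv<i _ _ = fv<i
    ... | tri≈ _ fv≡i _ = ⊥-elim (<⇒≱ fi<q (≤-trans (<⇒≤ q<v) (≤-reflexive (trans (sym (involutive v v<n)) (cong f fv≡i)))))
    ... | tri> _ _ i<fv = ⊥-elim (<⇒≱ (above-q-leftward (f v) i i<fv (after-q→below-q v q<v v<n)
                                        (subst (q <_) (sym (involutive v v<n)) q<v)) (<⇒≤ fi<q))

  middle→middle : ∀ i → k ≤ i → i < q → k ≤ f i × f i < q
  middle→middle i k≤i i<q = k≤fi , fi<q
    where
    i<n : i < n
    i<n = <-trans i<q q<n
    fi<q : f i < q
    fi<q with <-cmp (f i) q
    ... | tri< fi<q _ _ = fi<q
    ... | tri≈ _ fi≡q _ = ⊥-elim (≢q i<n (<⇒≢ i<q) fi≡q)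
    ... | tri> _ _ q<fi = ⊥-elim (<⇒≱ (s≤s k≤i) (interval-injection⇒≤ injective 0 (suc i) (suc q) k i<n
                            (λ x _ x≤i → q<f x (≤-pred x≤i) , subst (f x <_) (sym q+1+k≡n) (bounded x (≤-<-trans (≤-pred x≤i) i<n)))))
      where
      q<f : ∀ x → x ≤ i → q < f x
      q<f x x≤i with m≤n⇒m<n∨m≡n x≤i
      ... | inj₁ x<i  = above-q-leftward i x x<i i<q q<fi
      ... | inj₂ refl = q<fi
    k≤fi : k ≤ f i
    k≤fi with k ≤? f i
    ... | yes k≤fi = k≤fi
    ... | no  k≰fi = ⊥-elim (<⇒≱ i<q (<⇒≤ (subst (q <_) (involutive i i<n) (head→tail (f i) (≰⇒> k≰fi)))))

  tail→head : ∀ i → q < i → i < n → f i < k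
  tail→head i q<i i<n with f i <? k
  ... | yes fi<k = fi<k
  ... | no  fi≮k = ⊥-elim (<⇒≱ q<i (<⇒≤ (subst (_< q) (involutive i i<n)
                     (proj₂ (middle→middle (f i) (≮⇒≥ fi≮k) (after-q→below-q i q<i i<n))))))

-- If a 132-avoiding involution of [0, n] has f n = k < n, then with q = n - 1 - k it splits into blocks
-- [0, k) {k} (k, q] (q, n) {n}, the outer blocks [0, k) and (q, n) being swapped.
module LastValue {n f} (I : Involution132 (suc n) f) {k} (fn≡k : f n ≡ k) (k<n : k < n) where

  open Involution132 I

  q : ℕ
  q = n ∸ suc k

  k+1+q≡n : suc k + q ≡ n
  k+1+q≡n = m+[n∸m]≡n k<n

  private
    k<n+1 : k < suc n
    k<n+1 = m<n⇒m<1+n k<n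
    n<n+1 : n < suc n
    n<n+1 = n<1+n n

  fk≡n : f k ≡ n
  fk≡n = trans (cong f (sym fn≡k)) (involutive n n<n+1)

  f≢k : ∀ i → i < n → f i ≢ k
  f≢k i i<n fi≡k = <⇒≢ i<n (injective i n (m<n⇒m<1+n i<n) n<n+1 (trans fi≡k (sym fn≡k)))

  f<n : ∀ i → i ≤ n → i ≢ k → f i < n
  f<n i i≤n i≢k = ≤∧≢⇒< (≤-pred (bounded i (s≤s i≤n))) (λ fi≡n → i≢k (injective i k (s≤s i≤n) k<n+1 (trans fi≡n (sym fk≡n))))

  decreasing-across-k : ∀ i j → i < k → k < j → j ≤ n → f j < f i
  decreasing-across-k i j i<k k<j j≤n with <-cmp (f j) (f i)
  ... | tri< fj<fi _ _ = fj<fi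
  ... | tri≈ _ fj≡fi _ = ⊥-elim (<⇒≢ (<-trans i<k k<j) (sym (injective j i (s≤s j≤n) (<-trans i<k k<n+1) fj≡fi)))
  ... | tri> _ _ fi<fj = ⊥-elim (avoids132 i k j i<k k<j (s≤s j≤n) fi<fj
                            (subst (f j <_) (sym fk≡n) (f<n j j≤n (λ j≡k → <⇒≢ k<j (sym j≡k)))))

  k<head : ∀ i → i < k → k < f i
  k<head i i<k = subst (_< f i) fn≡k (decreasing-across-k i n i<k k<n ≤-refl)

  private
    head-value : ∀ i → i < k → k < f i × f i < n
    head-value i i<k = k<head i i<k , f<n i (<⇒≤ (<-trans i<k k<n)) (<⇒≢ i<k)

    ordered-by-preimage : ∀ p x → k < p → p < n → k < f p → x < n → f x < k → p < x
    ordered-by-preimage p x k<p p<n k<fp x<n fx<k =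
      subst₂ _<_ (involutive p (m<n⇒m<1+n p<n)) (involutive x (m<n⇒m<1+n x<n))
        (decreasing-across-k (f x) (f p) fx<k k<fp (<⇒≤ (f<n p (<⇒≤ p<n) (λ p≡k → <⇒≢ k<p (sym p≡k)))))

  k≤q : k ≤ q
  k≤q = interval-injection⇒≤ injective 0 k (suc k) q (<⇒≤ k<n+1)
          (λ j _ j<k → k<head j j<k , subst (f j <_) (sym k+1+q≡n) (proj₂ (head-value j j<k)))

  tail→head : ∀ i → q < i → i < n → f i < k
  tail→head i q<i i<n with <-cmp (f i) k
  ... | tri< fi<k _ _ = fi<k
  ... | tri≈ _ fi≡k _ = ⊥-elim (f≢k i i<n fi≡k)
  ... | tri> _ _ k<fi = ⊥-elim (<⇒≱ q<i (k≤n∸[i+1]⇒i≤q (interval-injection⇒≤ injective 0 k (suc i) (n ∸ suc i) (<⇒≤ k<n+1)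
                          (λ j _ j<k → after-i j j<k , subst (f j <_) (sym (m+[n∸m]≡n i<n)) (proj₂ (head-value j j<k))))))
    where
    after-i : ∀ j → j < k → suc i ≤ f j
    after-i j j<k = ordered-by-preimage i (f j) (≤-<-trans k≤q q<i) i<n k<fi (proj₂ (head-value j j<k))
                      (subst (_< k) (sym (involutive j (<-trans j<k k<n+1))) j<k)
    k≤n∸[i+1]⇒i≤q : k ≤ n ∸ suc i → i ≤ q
    k≤n∸[i+1]⇒i≤q k≤ = ≤-pred (+-cancelʳ-≤ k (suc i) (suc q) (begin
      suc i + k             ≤⟨ +-monoʳ-≤ (suc i) k≤ ⟩
      suc i + (n ∸ suc i)   ≡⟨ m+[n∸m]≡n i<n ⟩
      n                     ≡⟨ sym k+1+q≡n ⟩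
      suc k + q             ≡⟨ sym (+-suc k q) ⟩
      k + suc q             ≡⟨ +-comm k (suc q) ⟩
      suc q + k             ∎))
      where open ≤-Reasoning

  q<n : q < n
  q<n = subst (q <_) k+1+q≡n (s≤s (m≤n+m q k))

  middle→middle : ∀ i → k < i → i ≤ q → k < f i × f i ≤ q
  middle→middle i k<i i≤q = k<fi , fi≤q
    where
    i<n : i < n
    i<n = ≤-<-trans i≤q q<n
    k<fi : k < f i
    k<fi with <-cmp (f i) k
    ... | tri> _ _ k<fi = k<fi
    ... | tri≈ _ fi≡k _ = ⊥-elim (f≢k i i<n fi≡k)
    ... | tri< fi<k _ _ = ⊥-elim (<⇒≱ n∸i>k (interval-injection⇒≤ injective i (n ∸ i) 0 k
                            (m≤n⇒m≤1+n (≤-reflexive (m+[n∸m]≡n (<⇒≤ i<n))))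
                            (λ p i≤p p<n∸i → z≤n , after-i→head p i≤p (subst (p <_) (m+[n∸m]≡n (<⇒≤ i<n)) p<n∸i))))
      where
      after-i→head : ∀ p → i ≤ p → p < n → f p < k
      after-i→head p i≤p p<n with <-cmp (f p) k
      ... | tri< fp<k _ _ = fp<k
      ... | tri≈ _ fp≡k _ = ⊥-elim (f≢k p p<n fp≡k)
      ... | tri> _ _ k<fp = ⊥-elim (<⇒≱ (ordered-by-preimage p i (<-≤-trans k<i i≤p) p<n k<fp i<n fi<k) i≤p)
      n∸i>k : k < n ∸ i
      n∸i>k = subst (_≤ n ∸ i) (trans (cong (_∸ q) (sym k+1+q≡n)) (m+n∸n≡m (suc k) q)) (∸-monoʳ-≤ n i≤q)
    fi≤q : f i ≤ q
    fi≤q with f i ≤? q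
    ... | yes fi≤q = fi≤q
    ... | no  fi≰q = ⊥-elim (<⇒≱ k<i (<⇒≤ (subst (_< k) (involutive i (m<n⇒m<1+n i<n))
                       (tail→head (f i) (≰⇒> fi≰q) (f<n i (<⇒≤ i<n) (λ i≡k → <⇒≢ k<i (sym i≡k)))))))

  head→tail : ∀ i → i < k → q < f i
  head→tail i i<k with q <? f i
  ... | yes q<fi = q<fi
  ... | no  q≮fi = ⊥-elim (<⇒≱ i<k (<⇒≤ (subst (k <_) (involutive i (<-trans i<k k<n+1))
                     (proj₁ (middle→middle (f i) (k<head i i<k) (≮⇒≥ q≮fi))))))

-- Appending a fixed point, pairing up and unpairing

-- Kept abstract so that the piecewise definitions below only unfold through ifLt-< and ifLt-≥.
abstract
  ifLt : ℕ → ℕ → ℕ → ℕ → ℕ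
  ifLt i k a b = if i <ᵇ k then a else b

  ifLt-< : ∀ {i k a b} → i < k → ifLt i k a b ≡ a
  ifLt-< {i} {k} i<k with i <ᵇ k | <⇒<ᵇ i<k
  ... | true | _ = refl

  ifLt-≥ : ∀ {i k a b} → k ≤ i → ifLt i k a b ≡ b
  ifLt-≥ {i} {k} k≤i with i <ᵇ k | <ᵇ⇒< i k
  ... | true  | i<k = ⊥-elim (<⇒≱ (i<k _) k≤i)
  ... | false | _   = refl

ifLt-cong : ∀ {i k a a′ b b′} → (i < k → a ≡ a′) → (k ≤ i → b ≡ b′) → ifLt i k a b ≡ ifLt i k a′ b′
ifLt-cong {i} {k} a≡a′ b≡b′ with i <? k
... | yes i<k = trans (ifLt-< i<k) (trans (a≡a′ i<k) (sym (ifLt-< i<k)))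
... | no  i≮k = trans (ifLt-≥ (≮⇒≥ i≮k)) (trans (b≡b′ (≮⇒≥ i≮k)) (sym (ifLt-≥ (≮⇒≥ i≮k))))

appendFixedPoint : ℕ → (ℕ → ℕ) → ℕ → ℕ
appendFixedPoint n f i = ifLt i n (f i) n

-- With k = n - 1 - q: f on [0, k), the new two-cycle (k, n), f shifted up by one on (k, q], f on (q, n).
pairUp : ℕ → ℕ → (ℕ → ℕ) → ℕ → ℕ
pairUp n q f i = ifLt i k (f i) (ifLt i (suc k) n (ifLt i (suc q) (suc (f (i ∸ 1))) (ifLt i n (f i) k)))
  where
  k : ℕ
  k = n ∸ suc q

-- With q = n - 1 - k: f on [0, k), f shifted down by one on [k, q), the new fixed point q, f on (q, n).
unpair : ℕ → ℕ → (ℕ → ℕ) → ℕ → ℕ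
unpair n k f i = ifLt i k (f i) (ifLt i q (f (suc i) ∸ 1) (ifLt i (suc q) i (f i)))
  where
  q : ℕ
  q = n ∸ suc k

HasFixedPoint : ℕ → (ℕ → ℕ) → Set
HasFixedPoint n f = Σ ℕ λ j → j < n × f j ≡ j

maxFixedPoint : ℕ → (ℕ → ℕ) → ℕ
maxFixedPoint zero    f = 0
maxFixedPoint (suc m) f with f m ≟ m
... | yes _ = m
... | no  _ = maxFixedPoint m f

maxFixedPoint-isMax : ∀ m f → HasFixedPoint m f → IsMaxFixedPoint m f (maxFixedPoint m f)
maxFixedPoint-isMax (suc m) f (j , j<m+1 , fj≡j) with f m ≟ m
... | yes fm≡m = record { q<n = n<1+n m ; fixed = fm≡m ; last = λ i m<i i<m+1 → ⊥-elim (<⇒≱ m<i (≤-pred i<m+1)) }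
... | no  fm≢m = record { q<n = m<n⇒m<1+n q<n ; fixed = fixed ; last = last′ }
  where
  j<m : j < m
  j<m = ≤∧≢⇒< (≤-pred j<m+1) (λ j≡m → fm≢m (subst (λ x → f x ≡ x) j≡m fj≡j))
  open IsMaxFixedPoint (maxFixedPoint-isMax m f (j , j<m , fj≡j))
  last′ : ∀ i → maxFixedPoint m f < i → i < suc m → f i ≢ i
  last′ i q<i i<m+1 with m≤n⇒m<n∨m≡n (≤-pred i<m+1)
  ... | inj₁ i<m  = last i q<i i<m
  ... | inj₂ refl = fm≢m

maxFixedPoint-unique : ∀ m f q → IsMaxFixedPoint m f q → maxFixedPoint m f ≡ q
maxFixedPoint-unique (suc m) f q M with f m ≟ m | m≤n⇒m<n∨m≡n (≤-pred (IsMaxFixedPoint.q<n M))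
... | yes fm≡m | inj₁ q<m  = ⊥-elim (IsMaxFixedPoint.last M m q<m (n<1+n m) fm≡m)
... | yes _    | inj₂ q≡m  = sym q≡m
... | no  fm≢m | inj₂ refl = ⊥-elim (fm≢m (IsMaxFixedPoint.fixed M))
... | no  _    | inj₁ q<m  = maxFixedPoint-unique m f q (record
  { q<n = q<m ; fixed = IsMaxFixedPoint.fixed M ; last = λ i q<i i<m → IsMaxFixedPoint.last M i q<i (m<n⇒m<1+n i<m) })

maxFixedPoint-cong : ∀ m {f g} → (∀ i → i < m → f i ≡ g i) → maxFixedPoint m f ≡ maxFixedPoint m g
maxFixedPoint-cong zero    f≗g = refl
maxFixedPoint-cong (suc m) {f} {g} f≗g with f m ≟ m | g m ≟ m
... | yes _    | yes _    = refl
... | yes fm≡m | no  gm≢m = ⊥-elim (gm≢m (trans (sym (f≗g m (n<1+n m))) fm≡m))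
... | no  fm≢m | yes gm≡m = ⊥-elim (fm≢m (trans (f≗g m (n<1+n m)) gm≡m))
... | no  _    | no  _    = maxFixedPoint-cong m (λ i i<m → f≗g i (m<n⇒m<1+n i<m))

module PairUpValues (n q : ℕ) (f : ℕ → ℕ) (k≤q : n ∸ suc q ≤ q) (q<n : q < n) where

  k : ℕ
  k = n ∸ suc q

  on-head : ∀ i → i < k → pairUp n q f i ≡ f i
  on-head i i<k = ifLt-< i<k

  at-k : pairUp n q f k ≡ n
  at-k = trans (ifLt-≥ (≤-refl {k})) (ifLt-< (n<1+n k))

  on-middle : ∀ i → k < i → i ≤ q → pairUp n q f i ≡ suc (f (i ∸ 1))
  on-middle i k<i i≤q = trans (ifLt-≥ (<⇒≤ k<i)) (trans (ifLt-≥ k<i) (ifLt-< (s≤s i≤q)))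

  on-tail : ∀ i → q < i → i < n → pairUp n q f i ≡ f i
  on-tail i q<i i<n = trans (ifLt-≥ (≤-trans k≤q (<⇒≤ q<i))) (trans (ifLt-≥ (≤-<-trans k≤q q<i)) (trans (ifLt-≥ q<i) (ifLt-< i<n)))

  at-n : pairUp n q f n ≡ k
  at-n = trans (ifLt-≥ (≤-trans k≤q (<⇒≤ q<n))) (trans (ifLt-≥ (≤-<-trans k≤q q<n)) (trans (ifLt-≥ q<n) (ifLt-≥ (≤-refl {n}))))

module UnpairValues (n k : ℕ) (f : ℕ → ℕ) (k≤q : k ≤ n ∸ suc k) where

  q : ℕ
  q = n ∸ suc k

  on-head : ∀ i → i < k → unpair n k f i ≡ f i
  on-head i i<k = ifLt-< i<k

  on-middle : ∀ i → k ≤ i → i < q → unpair n k f i ≡ f (suc i) ∸ 1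
  on-middle i k≤i i<q = trans (ifLt-≥ k≤i) (ifLt-< i<q)

  at-q : unpair n k f q ≡ q
  at-q = trans (ifLt-≥ k≤q) (trans (ifLt-≥ (≤-refl {q})) (ifLt-< (n<1+n q)))

  on-tail : ∀ i → q < i → unpair n k f i ≡ f i
  on-tail i q<i = trans (ifLt-≥ (≤-trans k≤q (<⇒≤ q<i))) (trans (ifLt-≥ (<⇒≤ q<i)) (ifLt-≥ q<i))

pairUp-cong : ∀ n q {f g} → q < n → (∀ i → i < n → f i ≡ g i) → ∀ i → pairUp n q f i ≡ pairUp n q g i
pairUp-cong n q q<n f≗g i =
  ifLt-cong (λ i<k → f≗g i (<-≤-trans i<k (m∸n≤m n (suc q))))
    (λ _ → ifLt-cong (λ _ → refl)
      (λ _ → ifLt-cong (λ i≤q → cong suc (f≗g (i ∸ 1) (≤-<-trans (≤-trans (m∸n≤m i 1) (≤-pred i≤q)) q<n)))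
        (λ _ → ifLt-cong (f≗g i) (λ _ → refl))))

unpair-cong : ∀ n k {f g} → (∀ i → i ≤ n → f i ≡ g i) → ∀ i → i < n → unpair n k f i ≡ unpair n k g i
unpair-cong n k f≗g i i<n =
  ifLt-cong (λ _ → f≗g i (<⇒≤ i<n))
    (λ _ → ifLt-cong (λ i<q → cong (_∸ 1) (f≗g (suc i) (≤-trans i<q (m∸n≤m n (suc k)))))
      (λ _ → ifLt-cong (λ _ → refl) (λ _ → f≗g i (<⇒≤ i<n))))

-- A 132 pattern of g at unexceptional positions, where g = h ∘ f ∘ ψ there with ψ increasing
-- and h monotone, would be a 132 pattern of f.
avoids132-transfer : ∀ {N M} {g f ψ h : ℕ → ℕ} (S : ℕ → Set) → Avoids132On M f →
  (∀ p → p < N → ¬ S p → g p ≡ h (f (ψ p))) →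
  (∀ p p′ → p < p′ → p′ < N → ¬ S p → ¬ S p′ → ψ p < ψ p′) →
  (∀ p → p < N → ¬ S p → ψ p < M) →
  (∀ x y → x ≤ y → h x ≤ h y) →
  ∀ i j l → i < j → j < l → l < N → ¬ S i → ¬ S j → ¬ S l → g i < g l → g l < g j → ⊥
avoids132-transfer {N} {M} {g} {f} {ψ} {h} S avoids g≡hfψ ψ-increasing ψ<M h-monotone
                   i j l i<j j<l l<N ¬Si ¬Sj ¬Sl gi<gl gl<gj =
  avoids (ψ i) (ψ j) (ψ l) (ψ-increasing i j i<j j<N ¬Si ¬Sj) (ψ-increasing j l j<l l<N ¬Sj ¬Sl) (ψ<M l l<N ¬Sl)
    (reflect i l i<N l<N ¬Si ¬Sl gi<gl) (reflect l j l<N j<N ¬Sl ¬Sj gl<gj)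
  where
  j<N : j < N
  j<N = <-trans j<l l<N
  i<N : i < N
  i<N = <-trans i<j j<N
  reflect : ∀ x y → x < N → y < N → ¬ S x → ¬ S y → g x < g y → f (ψ x) < f (ψ y)
  reflect x y x<N y<N ¬Sx ¬Sy gx<gy with f (ψ x) <? f (ψ y)
  ... | yes fψx<fψy = fψx<fψy
  ... | no  fψx≮fψy = ⊥-elim (<⇒≱ (subst₂ _<_ (g≡hfψ x x<N ¬Sx) (g≡hfψ y y<N ¬Sy) gx<gy) (h-monotone _ _ (≮⇒≥ fψx≮fψy)))

Involution132-init : ∀ {n f} → Involution132 (suc n) f → f n ≡ n → Involution132 n f
Involution132-init {n} {f} I fn≡n = record
  { bounded    = λ i i<n → ≤∧≢⇒< (≤-pred (bounded i (m<n⇒m<1+n i<n)))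
                              (λ fi≡n → <⇒≢ i<n (injective i n (m<n⇒m<1+n i<n) (n<1+n n) (trans fi≡n (sym fn≡n))))
  ; involutive = λ i i<n → involutive i (m<n⇒m<1+n i<n)
  ; avoids132  = λ i j l i<j j<l l<n → avoids132 i j l i<j j<l (m<n⇒m<1+n l<n)
  }
  where open Involution132 I

appendFixedPoint-Involution132 : ∀ {n f} → Involution132 n f → Involution132 (suc n) (appendFixedPoint n f)
appendFixedPoint-Involution132 {n} {f} I = record { bounded = bounded′ ; involutive = involutive′ ; avoids132 = avoids132′ }
  where
  open Involution132 I
  g : ℕ → ℕ
  g = appendFixedPoint n f
  g≡f : ∀ i → i < n → g i ≡ f i
  g≡f i i<n = ifLt-< i<n
  gn≡n : g n ≡ n
  gn≡n = ifLt-≥ (≤-refl {n})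
  bounded′ : ∀ i → i < suc n → g i < suc n
  bounded′ i i<n+1 with m≤n⇒m<n∨m≡n (≤-pred i<n+1)
  ... | inj₁ i<n  = subst (_< suc n) (sym (g≡f i i<n)) (m<n⇒m<1+n (bounded i i<n))
  ... | inj₂ refl = subst (_< suc n) (sym gn≡n) (n<1+n n)
  involutive′ : ∀ i → i < suc n → g (g i) ≡ i
  involutive′ i i<n+1 with m≤n⇒m<n∨m≡n (≤-pred i<n+1)
  ... | inj₁ i<n  = trans (cong g (g≡f i i<n)) (trans (g≡f (f i) (bounded i i<n)) (involutive i i<n))
  ... | inj₂ refl = trans (cong g gn≡n) gn≡n
  avoids132′ : Avoids132On (suc n) g
  avoids132′ i j l i<j j<l l<n+1 gi<gl gl<gj with m≤n⇒m<n∨m≡n (≤-pred l<n+1)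
  ... | inj₁ l<n  = avoids132 i j l i<j j<l l<n (subst₂ _<_ (g≡f i (<-trans i<j (<-trans j<l l<n))) (g≡f l l<n) gi<gl)
                                               (subst₂ _<_ (g≡f l l<n) (g≡f j (<-trans j<l l<n)) gl<gj)
  ... | inj₂ refl = <⇒≱ (subst₂ _<_ gn≡n (g≡f j j<l) gl<gj) (<⇒≤ (bounded j j<l))

∸-complement-involutive : ∀ {n q} → q < n → n ∸ suc (n ∸ suc q) ≡ q
∸-complement-involutive (s≤s q≤n) = m∸[m∸n]≡n q≤n

module PairUp {n f} (I : Involution132 n f) {q} (M : IsMaxFixedPoint n f q) where

  open Involution132 I
  open IsMaxFixedPoint M
  open MaxFixedPoint I M public
  open PairUpValues n q f k≤q q<n public hiding (k)

  g : ℕ → ℕ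
  g = pairUp n q f

  k<n : k < n
  k<n = ≤-<-trans k≤q q<n

  private
    k<n+1 : k < suc n
    k<n+1 = m<n⇒m<1+n k<n

  data Position (p : ℕ) : Set where
    in-head   : p < k → Position p
    is-k      : p ≡ k → Position p
    in-middle : ∀ {p′} → p ≡ suc p′ → k ≤ p′ → p′ < q → Position p
    in-tail   : q < p → p < n → Position p
    is-n      : p ≡ n → Position p

  position : ∀ p → p ≤ n → Position p
  position p p≤n with <-cmp p k
  ... | tri< p<k _ _ = in-head p<k
  ... | tri≈ _ p≡k _ = is-k p≡k
  ... | tri> _ _ k<p with p ≤? q | m≤n⇒m<n∨m≡n p≤n
  ...   | no  p≰q | inj₁ p<n  = in-tail (≰⇒> p≰q) p<n
  ...   | no  _   | inj₂ p≡n  = is-n p≡n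
  ...   | yes p≤q | _ with p | k<p
  ...     | suc p′ | s≤s k≤p′ = in-middle refl k≤p′ p≤q

  head-values : ∀ p → p < k → g p ≡ f p × q < f p × f p < n
  head-values p p<k = on-head p p<k , head→tail p p<k , bounded p (<-trans p<k k<n)

  middle-values : ∀ p → k ≤ p → p < q → g (suc p) ≡ suc (f p) × k ≤ f p × f p < q
  middle-values p k≤p p<q = on-middle (suc p) (s≤s k≤p) p<q , middle→middle p k≤p p<q

  tail-values : ∀ p → q < p → p < n → g p ≡ f p × f p < k
  tail-values p q<p p<n = on-tail p q<p p<n , tail→head p q<p p<n

  bounded′ : ∀ p → p < suc n → g p < suc n
  bounded′ p p<n+1 with position p (≤-pred p<n+1)
  ... | in-head p<k = subst (_< suc n) (sym (proj₁ (head-values p p<k))) (m<n⇒m<1+n (proj₂ (proj₂ (head-values p p<k))))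
  ... | is-k refl = subst (_< suc n) (sym at-k) (n<1+n n)
  ... | in-middle refl k≤p′ p′<q = let (gp≡ , _ , fp′<q) = middle-values _ k≤p′ p′<q in
    subst (_< suc n) (sym gp≡) (s≤s (<-trans fp′<q q<n))
  ... | in-tail q<p p<n = subst (_< suc n) (sym (proj₁ (tail-values p q<p p<n))) (<-trans (proj₂ (tail-values p q<p p<n)) k<n+1)
  ... | is-n refl = subst (_< suc n) (sym at-n) k<n+1

  involutive′ : ∀ p → p < suc n → g (g p) ≡ p
  involutive′ p p<n+1 with position p (≤-pred p<n+1)
  ... | in-head p<k = let (gp≡fp , q<fp , fp<n) = head-values p p<k in
    trans (cong g gp≡fp) (trans (proj₁ (tail-values (f p) q<fp fp<n)) (involutive p (<-trans p<k k<n)))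
  ... | is-k refl = trans (cong g at-k) at-n
  ... | in-middle {p′} refl k≤p′ p′<q = let (gp≡ , k≤fp′ , fp′<q) = middle-values p′ k≤p′ p′<q in
    trans (cong g gp≡) (trans (proj₁ (middle-values (f p′) k≤fp′ fp′<q)) (cong suc (involutive p′ (<-trans p′<q q<n))))
  ... | in-tail q<p p<n = let (gp≡fp , fp<k) = tail-values p q<p p<n in
    trans (cong g gp≡fp) (trans (on-head (f p) fp<k) (involutive p p<n))
  ... | is-n refl = trans (cong g at-n) at-k

  source : ℕ → ℕ
  source p = ifLt p (suc k) p (ifLt p (suc q) (p ∸ 1) p)

  relabel : ℕ → ℕ
  relabel v = ifLt v k v (ifLt v q (suc v) v)

  relabel-low : ∀ v → v < k → relabel v ≡ v
  relabel-low v v<k = ifLt-< v<k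

  relabel-middle : ∀ v → k ≤ v → v < q → relabel v ≡ suc v
  relabel-middle v k≤v v<q = trans (ifLt-≥ k≤v) (ifLt-< v<q)

  relabel-high : ∀ v → q ≤ v → relabel v ≡ v
  relabel-high v q≤v = trans (ifLt-≥ (≤-trans k≤q q≤v)) (ifLt-≥ q≤v)

  relabel-inflationary : ∀ v → v ≤ relabel v
  relabel-inflationary v with v <? k | v <? q
  ... | yes v<k | _       = ≤-reflexive (sym (relabel-low v v<k))
  ... | no  v≮k | yes v<q = ≤-trans (n≤1+n v) (≤-reflexive (sym (relabel-middle v (≮⇒≥ v≮k) v<q)))
  ... | no  _   | no  v≮q = ≤-reflexive (sym (relabel-high v (≮⇒≥ v≮q)))

  relabel-monotone : ∀ x y → x ≤ y → relabel x ≤ relabel y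
  relabel-monotone x y x≤y with x <? k | x <? q
  ... | yes x<k | _       = ≤-trans (≤-reflexive (relabel-low x x<k)) (≤-trans x≤y (relabel-inflationary y))
  ... | no  _   | no  x≮q = ≤-trans (≤-reflexive (relabel-high x (≮⇒≥ x≮q))) (≤-trans x≤y (relabel-inflationary y))
  ... | no  x≮k | yes x<q with y <? q
  ...   | yes y<q = ≤-trans (≤-reflexive (relabel-middle x (≮⇒≥ x≮k) x<q))
                      (≤-trans (s≤s x≤y) (≤-reflexive (sym (relabel-middle y (≤-trans (≮⇒≥ x≮k) x≤y) y<q))))
  ...   | no  y≮q = ≤-trans (≤-reflexive (relabel-middle x (≮⇒≥ x≮k) x<q))
                      (≤-trans x<q (≤-trans (≮⇒≥ y≮q) (≤-reflexive (sym (relabel-high y (≮⇒≥ y≮q))))))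

  source-head : ∀ p → p < k → source p ≡ p
  source-head p p<k = ifLt-< (m<n⇒m<1+n p<k)

  source-middle : ∀ p → k < p → p ≤ q → source p ≡ p ∸ 1
  source-middle p k<p p≤q = trans (ifLt-≥ k<p) (ifLt-< (s≤s p≤q))

  source-tail : ∀ p → q < p → source p ≡ p
  source-tail p q<p = trans (ifLt-≥ (≤-<-trans k≤q q<p)) (ifLt-≥ q<p)

  OnNewPair : ℕ → Set
  OnNewPair p = p ≡ k ⊎ p ≡ n

  g≡relabel∘f∘source : ∀ p → p < suc n → ¬ OnNewPair p → g p ≡ relabel (f (source p))
  g≡relabel∘f∘source p p<n+1 ¬new with position p (≤-pred p<n+1)
  ... | is-k p≡k = ⊥-elim (¬new (inj₁ p≡k))
  ... | is-n p≡n = ⊥-elim (¬new (inj₂ p≡n))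
  ... | in-head p<k = let (gp≡fp , q<fp , _) = head-values p p<k in
    trans gp≡fp (trans (sym (relabel-high (f p) (<⇒≤ q<fp))) (cong (relabel ∘′ f) (sym (source-head p p<k))))
  ... | in-tail q<p p<n = let (gp≡fp , fp<k) = tail-values p q<p p<n in
    trans gp≡fp (trans (sym (relabel-low (f p) fp<k)) (cong (relabel ∘′ f) (sym (source-tail p q<p))))
  ... | in-middle {p′} refl k≤p′ p′<q = let (gp≡ , k≤fp′ , fp′<q) = middle-values p′ k≤p′ p′<q in
    trans gp≡ (trans (sym (relabel-middle (f p′) k≤fp′ fp′<q)) (cong (relabel ∘′ f) (sym (source-middle (suc p′) (s≤s k≤p′) p′<q))))

  source≤ : ∀ p → p < suc n → ¬ OnNewPair p → source p ≤ p
  source≤ p p<n+1 ¬new with position p (≤-pred p<n+1)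
  ... | is-k p≡k = ⊥-elim (¬new (inj₁ p≡k))
  ... | is-n p≡n = ⊥-elim (¬new (inj₂ p≡n))
  ... | in-head p<k = ≤-reflexive (source-head p p<k)
  ... | in-tail q<p _ = ≤-reflexive (source-tail p q<p)
  ... | in-middle {p′} refl k≤p′ p′<q = ≤-trans (≤-reflexive (source-middle (suc p′) (s≤s k≤p′) p′<q)) (n≤1+n p′)

  source<n : ∀ p → p < suc n → ¬ OnNewPair p → source p < n
  source<n p p<n+1 ¬new = ≤-<-trans (source≤ p p<n+1 ¬new) (≤∧≢⇒< (≤-pred p<n+1) (λ p≡n → ¬new (inj₂ p≡n)))

  source-increasing : ∀ p p′ → p < p′ → p′ < suc n → ¬ OnNewPair p → ¬ OnNewPair p′ → source p < source p′
  source-increasing p p′ p<p′ p′<n+1 ¬new ¬new′ with position p′ (≤-pred p′<n+1)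
  ... | is-k p′≡k = ⊥-elim (¬new′ (inj₁ p′≡k))
  ... | is-n p′≡n = ⊥-elim (¬new′ (inj₂ p′≡n))
  ... | in-head p′<k = subst₂ _<_ (sym (source-head p (<-trans p<p′ p′<k))) (sym (source-head p′ p′<k)) p<p′
  ... | in-tail q<p′ _ = ≤-<-trans (source≤ p (<-trans p<p′ p′<n+1) ¬new) (subst (p <_) (sym (source-tail p′ q<p′)) p<p′)
  ... | in-middle {r′} refl k≤r′ r′<q with position p (≤-pred (<-trans p<p′ p′<n+1))
  ...   | is-k p≡k = ⊥-elim (¬new (inj₁ p≡k))
  ...   | is-n p≡n = ⊥-elim (¬new (inj₂ p≡n))
  ...   | in-tail q<p _ = ⊥-elim (<⇒≱ (<-trans q<p p<p′) r′<q)
  ...   | in-head p<k = subst₂ _<_ (sym (source-head p p<k)) (sym (source-middle (suc r′) (s≤s k≤r′) r′<q)) (<-≤-trans p<k k≤r′)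
  ...   | in-middle {s′} refl k≤s′ s′<q = subst₂ _<_ (sym (source-middle (suc s′) (s≤s k≤s′) s′<q))
                                            (sym (source-middle (suc r′) (s≤s k≤r′) r′<q)) (≤-pred p<p′)

  g≤q-after-k : ∀ l → k < l → l < n → g l ≤ q
  g≤q-after-k l k<l l<n with position l (<⇒≤ l<n)
  ... | in-head l<k = ⊥-elim (<-asym k<l l<k)
  ... | is-k l≡k = ⊥-elim (<⇒≢ k<l (sym l≡k))
  ... | is-n l≡n = ⊥-elim (<⇒≢ l<n l≡n)
  ... | in-middle {l′} refl k≤l′ l′<q = let (gl≡ , _ , fl′<q) = middle-values l′ k≤l′ l′<q in
    subst (_≤ q) (sym gl≡) fl′<q
  ... | in-tail q<l _ = ≤-trans (<⇒≤ (subst (_< k) (sym (proj₁ (tail-values l q<l l<n))) (proj₂ (tail-values l q<l l<n)))) k≤q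

  avoids132′ : Avoids132On (suc n) g
  avoids132′ i j l i<j j<l l<n+1 gi<gl gl<gj with l ≟ n | l ≟ k | j ≟ k | i ≟ k
  ... | yes refl | _ | _ | _ = last-is-n
    where
    last-is-n : ⊥
    last-is-n with position i (<⇒≤ (<-trans i<j j<l))
    ... | in-head i<k = <⇒≱ (<-trans (proj₁ (proj₂ (head-values i i<k))) (subst₂ _<_ (proj₁ (head-values i i<k)) at-n gi<gl)) k≤q
    ... | is-k refl = <⇒≱ (subst₂ _<_ at-k at-n gi<gl) (<⇒≤ k<n)
    ... | is-n refl = <⇒≱ (<-trans i<j j<l) ≤-refl
    ... | in-tail q<i _ = let (gj≡fj , fj<k) = tail-values j (<-trans q<i i<j) j<l in
      <⇒≱ (subst₂ _<_ at-n gj≡fj gl<gj) (<⇒≤ fj<k)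
    ... | in-middle {i′} refl k≤i′ i′<q = let (gi≡ , k≤fi′ , _) = middle-values i′ k≤i′ i′<q in
      <⇒≱ (subst₂ _<_ gi≡ at-n gi<gl) (≤-trans k≤fi′ (n≤1+n _))
  ... | no _ | yes refl | _ | _ = <⇒≱ (subst (_< g j) at-k gl<gj) (≤-pred (bounded′ j (<-trans j<l l<n+1)))
  ... | no l≢n | no _ | yes refl | _ =
    <⇒≱ (subst (_< g l) (proj₁ (head-values i i<j)) gi<gl)
        (≤-trans (g≤q-after-k l j<l (≤∧≢⇒< (≤-pred l<n+1) l≢n)) (<⇒≤ (proj₁ (proj₂ (head-values i i<j)))))
  ... | no _ | no _ | no _ | yes refl = <⇒≱ (subst (_< g l) at-k gi<gl) (≤-pred (bounded′ l l<n+1))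
  ... | no l≢n | no l≢k | no j≢k | no i≢k =
    avoids132-transfer {g = g} {f} {source} {relabel} OnNewPair avoids132 g≡relabel∘f∘source source-increasing source<n relabel-monotone
      i j l i<j j<l l<n+1 (unexceptional i≢k (<⇒≢ (<-≤-trans (<-trans i<j j<l) (≤-pred l<n+1))))
      (unexceptional j≢k (<⇒≢ (<-≤-trans j<l (≤-pred l<n+1)))) (unexceptional l≢k l≢n) gi<gl gl<gj
    where
    unexceptional : ∀ {p} → p ≢ k → p ≢ n → ¬ OnNewPair p
    unexceptional p≢k _   (inj₁ p≡k) = p≢k p≡k
    unexceptional _   p≢n (inj₂ p≡n) = p≢n p≡n

  involution132 : Involution132 (suc n) g
  involution132 = record { bounded = bounded′ ; involutive = involutive′ ; avoids132 = avoids132′ }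

  unpair-pairUp : ∀ i → i < n → unpair n (g n) g i ≡ f i
  unpair-pairUp i i<n = trans (cong (λ x → unpair n x g i) at-n) (unpair-k i i<n)
    where
    n∸[k+1]≡q : n ∸ suc k ≡ q
    n∸[k+1]≡q = ∸-complement-involutive q<n
    module Back = UnpairValues n k g (subst (k ≤_) (sym n∸[k+1]≡q) k≤q)
    unpair-k : ∀ i → i < n → unpair n k g i ≡ f i
    unpair-k i i<n with i <? k | <-cmp i q
    ... | yes i<k | _ = trans (Back.on-head i i<k) (on-head i i<k)
    ... | no  i≮k | tri< i<q _ _ =
      trans (Back.on-middle i (≮⇒≥ i≮k) (subst (i <_) (sym n∸[k+1]≡q) i<q)) (cong (_∸ 1) (on-middle (suc i) (s≤s (≮⇒≥ i≮k)) i<q))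
    ... | no  _   | tri≈ _ refl _ = trans (subst (λ x → unpair n k g x ≡ x) n∸[k+1]≡q Back.at-q) (sym fixed)
    ... | no  _   | tri> _ _ q<i = trans (Back.on-tail i (subst (_< i) (sym n∸[k+1]≡q) q<i)) (on-tail i q<i i<n)

module Unpair {n f} (I : Involution132 (suc n) f) {k} (fn≡k : f n ≡ k) (k<n : k < n) where

  open Involution132 I
  open LastValue I fn≡k k<n public
  open UnpairValues n k f k≤q public hiding (q)

  n∸[q+1]≡k : n ∸ suc q ≡ k
  n∸[q+1]≡k = ∸-complement-involutive k<n

  g : ℕ → ℕ
  g = unpair n k f

  private
    module Forth = PairUpValues n q g (subst (_≤ q) (sym n∸[q+1]≡k) k≤q) q<n

  private
    n<n+1 : n < suc n
    n<n+1 = n<1+n n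
    k<n+1 : k < suc n
    k<n+1 = m<n⇒m<1+n k<n
    pred-suc : ∀ {x} → 0 < x → suc (x ∸ 1) ≡ x
    pred-suc {suc x} _ = refl

  data Position (p : ℕ) : Set where
    in-head   : p < k → Position p
    in-middle : k ≤ p → p < q → Position p
    is-q      : p ≡ q → Position p
    in-tail   : q < p → p < n → Position p

  position : ∀ p → p < n → Position p
  position p p<n with p <? k
  ... | yes p<k = in-head p<k
  ... | no  p≮k with <-cmp p q
  ...   | tri< p<q _ _ = in-middle (≮⇒≥ p≮k) p<q
  ...   | tri≈ _ p≡q _ = is-q p≡q
  ...   | tri> _ _ q<p = in-tail q<p p<n

  head-values : ∀ p → p < k → g p ≡ f p × q < f p × f p < n
  head-values p p<k = on-head p p<k , head→tail p p<k , f<n p (<⇒≤ (<-trans p<k k<n)) (<⇒≢ p<k)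

  middle-values : ∀ p → k ≤ p → p < q → g p ≡ f (suc p) ∸ 1 × k < f (suc p) × f (suc p) ≤ q
  middle-values p k≤p p<q = on-middle p k≤p p<q , middle→middle (suc p) (s≤s k≤p) p<q

  tail-values : ∀ p → q < p → p < n → g p ≡ f p × f p < k
  tail-values p q<p p<n = on-tail p q<p , tail→head p q<p p<n

  middle-bounds : ∀ p → k ≤ p → p < q → k ≤ g p × g p < q
  middle-bounds p k≤p p<q =
    subst (k ≤_) (sym gp≡) (≤-pred (subst (k <_) (sym (pred-suc (≤-<-trans z≤n k<f))) k<f)) ,
    subst (_< q) (sym gp≡) (subst (_≤ q) (sym (pred-suc (≤-<-trans z≤n k<f))) f≤q)
    where
    gp≡ : g p ≡ f (suc p) ∸ 1
    gp≡ = proj₁ (middle-values p k≤p p<q)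
    k<f : k < f (suc p)
    k<f = proj₁ (proj₂ (middle-values p k≤p p<q))
    f≤q : f (suc p) ≤ q
    f≤q = proj₂ (proj₂ (middle-values p k≤p p<q))

  bounded′ : ∀ p → p < n → g p < n
  bounded′ p p<n with position p p<n
  ... | in-head p<k = subst (_< n) (sym (proj₁ (head-values p p<k))) (proj₂ (proj₂ (head-values p p<k)))
  ... | in-middle k≤p p<q = <-trans (proj₂ (middle-bounds p k≤p p<q)) q<n
  ... | is-q refl = subst (_< n) (sym at-q) q<n
  ... | in-tail q<p _ = subst (_< n) (sym (proj₁ (tail-values p q<p p<n))) (<-trans (proj₂ (tail-values p q<p p<n)) k<n)

  involutive′ : ∀ p → p < n → g (g p) ≡ p
  involutive′ p p<n with position p p<n
  ... | in-head p<k = let (gp≡fp , q<fp , _) = head-values p p<k in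
    trans (cong g gp≡fp) (trans (on-tail (f p) q<fp) (involutive p (m<n⇒m<1+n p<n)))
  ... | is-q refl = trans (cong g at-q) at-q
  ... | in-tail q<p _ = let (gp≡fp , fp<k) = tail-values p q<p p<n in
    trans (cong g gp≡fp) (trans (on-head (f p) fp<k) (involutive p (m<n⇒m<1+n p<n)))
  ... | in-middle k≤p p<q = begin
    g (g p)                      ≡⟨ on-middle (g p) (proj₁ (middle-bounds p k≤p p<q)) (proj₂ (middle-bounds p k≤p p<q)) ⟩
    f (suc (g p)) ∸ 1            ≡⟨ cong (λ x → f (suc x) ∸ 1) (proj₁ (middle-values p k≤p p<q)) ⟩
    f (suc (f (suc p) ∸ 1)) ∸ 1  ≡⟨ cong (λ x → f x ∸ 1) (pred-suc (≤-<-trans z≤n (proj₁ (proj₂ (middle-values p k≤p p<q))))) ⟩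
    f (f (suc p)) ∸ 1            ≡⟨ cong (_∸ 1) (involutive (suc p) (s≤s p<n)) ⟩
    p                            ∎
    where open ≡-Reasoning

  source : ℕ → ℕ
  source p = ifLt p k p (ifLt p q (suc p) p)

  relabel : ℕ → ℕ
  relabel v = ifLt v (suc k) v (ifLt v (suc q) (v ∸ 1) v)

  relabel-low : ∀ v → v ≤ k → relabel v ≡ v
  relabel-low v v≤k = ifLt-< (s≤s v≤k)

  relabel-middle : ∀ v → k < v → v ≤ q → relabel v ≡ v ∸ 1
  relabel-middle v k<v v≤q = trans (ifLt-≥ k<v) (ifLt-< (s≤s v≤q))

  relabel-high : ∀ v → q < v → relabel v ≡ v
  relabel-high v q<v = trans (ifLt-≥ (≤-<-trans k≤q q<v)) (ifLt-≥ q<v)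

  relabel-≥pred : ∀ v → v ∸ 1 ≤ relabel v
  relabel-≥pred v with v ≤? k | v ≤? q
  ... | yes v≤k | _       = ≤-trans (m∸n≤m v 1) (≤-reflexive (sym (relabel-low v v≤k)))
  ... | no  v≰k | yes v≤q = ≤-reflexive (sym (relabel-middle v (≰⇒> v≰k) v≤q))
  ... | no  _   | no  v≰q = ≤-trans (m∸n≤m v 1) (≤-reflexive (sym (relabel-high v (≰⇒> v≰q))))

  relabel-monotone : ∀ x y → x ≤ y → relabel x ≤ relabel y
  relabel-monotone x y x≤y with x ≤? k | x ≤? q
  ... | yes x≤k | _ = ≤-trans (≤-reflexive (relabel-low x x≤k)) x≤relabel-y
    where
    x≤relabel-y : x ≤ relabel y
    x≤relabel-y with y ≤? k
    ... | yes y≤k = subst (x ≤_) (sym (relabel-low y y≤k)) x≤y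
    ... | no  y≰k = ≤-trans x≤k (≤-trans (≤-pred (subst (k <_) (sym (pred-suc (≤-<-trans z≤n (≰⇒> y≰k)))) (≰⇒> y≰k)))
                                         (relabel-≥pred y))
  ... | no  x≰k | yes x≤q = ≤-trans (≤-reflexive (relabel-middle x (≰⇒> x≰k) x≤q)) (≤-trans (∸-monoˡ-≤ 1 x≤y) (relabel-≥pred y))
  ... | no  _   | no  x≰q = ≤-trans (≤-reflexive (relabel-high x (≰⇒> x≰q)))
                                (≤-trans x≤y (≤-reflexive (sym (relabel-high y (<-≤-trans (≰⇒> x≰q) x≤y)))))

  source-head : ∀ p → p < k → source p ≡ p
  source-head p p<k = ifLt-< p<k

  source-middle : ∀ p → k ≤ p → p < q → source p ≡ suc p
  source-middle p k≤p p<q = trans (ifLt-≥ k≤p) (ifLt-< p<q)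

  source-tail : ∀ p → q < p → source p ≡ p
  source-tail p q<p = trans (ifLt-≥ (≤-trans k≤q (<⇒≤ q<p))) (ifLt-≥ (<⇒≤ q<p))

  source≤suc : ∀ p → source p ≤ suc p
  source≤suc p with p <? k | p <? q
  ... | yes p<k | _       = ≤-trans (≤-reflexive (source-head p p<k)) (n≤1+n p)
  ... | no  p≮k | yes p<q = ≤-reflexive (source-middle p (≮⇒≥ p≮k) p<q)
  ... | no  p≮k | no  p≮q = ≤-trans (≤-reflexive (trans (ifLt-≥ (≮⇒≥ p≮k)) (ifLt-≥ (≮⇒≥ p≮q)))) (n≤1+n p)

  IsNewFixedPoint : ℕ → Set
  IsNewFixedPoint p = p ≡ q

  g≡relabel∘f∘source : ∀ p → p < n → ¬ IsNewFixedPoint p → g p ≡ relabel (f (source p))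
  g≡relabel∘f∘source p p<n ¬new with position p p<n
  ... | is-q p≡q = ⊥-elim (¬new p≡q)
  ... | in-head p<k = let (gp≡fp , q<fp , _) = head-values p p<k in
    trans gp≡fp (trans (sym (relabel-high (f p) q<fp)) (cong (relabel ∘′ f) (sym (source-head p p<k))))
  ... | in-tail q<p _ = let (gp≡fp , fp<k) = tail-values p q<p p<n in
    trans gp≡fp (trans (sym (relabel-low (f p) (<⇒≤ fp<k))) (cong (relabel ∘′ f) (sym (source-tail p q<p))))
  ... | in-middle k≤p p<q = let (gp≡ , k<f , f≤q) = middle-values p k≤p p<q in
    trans gp≡ (trans (sym (relabel-middle (f (suc p)) k<f f≤q)) (cong (relabel ∘′ f) (sym (source-middle p k≤p p<q))))

  source-increasing : ∀ p p′ → p < p′ → p′ < n → ¬ IsNewFixedPoint p → ¬ IsNewFixedPoint p′ → source p < source p′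
  source-increasing p p′ p<p′ p′<n ¬new ¬new′ with position p′ p′<n
  ... | is-q p′≡q = ⊥-elim (¬new′ p′≡q)
  ... | in-head p′<k = subst₂ _<_ (sym (source-head p (<-trans p<p′ p′<k))) (sym (source-head p′ p′<k)) p<p′
  ... | in-middle k≤p′ p′<q = ≤-<-trans (≤-trans (source≤suc p) p<p′) (subst (p′ <_) (sym (source-middle p′ k≤p′ p′<q)) (n<1+n p′))
  ... | in-tail q<p′ _ with position p (<-trans p<p′ p′<n)
  ...   | is-q p≡q = ⊥-elim (¬new p≡q)
  ...   | in-head p<k = subst₂ _<_ (sym (source-head p p<k)) (sym (source-tail p′ q<p′)) p<p′
  ...   | in-tail q<p _ = subst₂ _<_ (sym (source-tail p q<p)) (sym (source-tail p′ q<p′)) p<p′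
  ...   | in-middle k≤p p<q = subst₂ _<_ (sym (source-middle p k≤p p<q)) (sym (source-tail p′ q<p′)) (≤-<-trans p<q q<p′)

  source<n+1 : ∀ p → p < n → ¬ IsNewFixedPoint p → source p < suc n
  source<n+1 p p<n _ = s≤s (≤-trans (source≤suc p) p<n)

  k≤g-before-q : ∀ i → i < q → k ≤ g i
  k≤g-before-q i i<q with position i (<-trans i<q q<n)
  ... | in-head i<k = ≤-trans k≤q (<⇒≤ (subst (q <_) (sym (proj₁ (head-values i i<k))) (proj₁ (proj₂ (head-values i i<k)))))
  ... | in-middle k≤i i<q′ = proj₁ (middle-bounds i k≤i i<q′)
  ... | is-q i≡q = ⊥-elim (<⇒≢ i<q i≡q)
  ... | in-tail q<i _ = ⊥-elim (<-asym i<q q<i)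

  avoids132′ : Avoids132On n g
  avoids132′ i j l i<j j<l l<n gi<gl gl<gj with i ≟ q | j ≟ q | l ≟ q
  ... | yes refl | _ | _ = let (gl≡fl , fl<k) = tail-values l (<-trans i<j j<l) l<n in
    <⇒≱ (subst (_< g l) at-q gi<gl) (≤-trans (<⇒≤ (subst (_< k) (sym gl≡fl) fl<k)) k≤q)
  ... | no _ | yes refl | _ = let (gl≡fl , fl<k) = tail-values l j<l l<n in
    <⇒≱ (<-trans gi<gl (subst (_< k) (sym gl≡fl) fl<k)) (k≤g-before-q i i<j)
  ... | no _ | no j≢q | yes refl = last-is-q
    where
    last-is-q : ⊥
    last-is-q with position j (<-trans j<l l<n)
    ... | in-head j<k = let (gi≡fi , q<fi , _) = head-values i (<-trans i<j j<k) in
      <⇒≱ (subst (_< l) gi≡fi (subst (g i <_) at-q gi<gl)) (<⇒≤ q<fi)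
    ... | in-middle k≤j j<q = <⇒≱ (subst (_< g j) at-q gl<gj) (<⇒≤ (proj₂ (middle-bounds j k≤j j<q)))
    ... | is-q j≡q = j≢q j≡q
    ... | in-tail q<j _ = <⇒≱ j<l (<⇒≤ q<j)
  ... | no i≢q | no j≢q | no l≢q =
    avoids132-transfer {g = g} {f} {source} {relabel} IsNewFixedPoint avoids132 g≡relabel∘f∘source source-increasing source<n+1 relabel-monotone
      i j l i<j j<l l<n i≢q j≢q l≢q gi<gl gl<gj

  involution132 : Involution132 n g
  involution132 = record { bounded = bounded′ ; involutive = involutive′ ; avoids132 = avoids132′ }

  isMaxFixedPoint : IsMaxFixedPoint n g q
  isMaxFixedPoint = record
    { q<n   = q<n
    ; fixed = at-q
    ; last  = λ i q<i i<n gi≡i → <⇒≱ (≤-<-trans k≤q q<i) (<⇒≤ (subst (_< k) (trans (sym (on-tail i q<i)) gi≡i) (tail→head i q<i i<n)))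
    }

  pairUp-unpair : ∀ i → i ≤ n → pairUp n q g i ≡ f i
  pairUp-unpair i i≤n with <-cmp i k
  ... | tri< i<k _ _ = trans (Forth.on-head i (subst (i <_) (sym n∸[q+1]≡k) i<k)) (on-head i i<k)
  ... | tri≈ _ refl _ = trans (subst (λ x → pairUp n q g x ≡ n) n∸[q+1]≡k Forth.at-k) (sym fk≡n)
  ... | tri> _ _ k<i with i ≤? q | m≤n⇒m<n∨m≡n i≤n
  ...   | yes i≤q | _ = trans (Forth.on-middle i (subst (_< i) (sym n∸[q+1]≡k) k<i) i≤q) (middle i k<i i≤q)
    where
    middle : ∀ i → k < i → i ≤ q → suc (g (i ∸ 1)) ≡ f i
    middle (suc i) (s≤s k≤i) i<q =
      trans (cong suc (on-middle i k≤i i<q)) (pred-suc (≤-<-trans z≤n (proj₁ (middle→middle (suc i) (s≤s k≤i) i<q))))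
  ...   | no  i≰q | inj₁ i<n  = trans (Forth.on-tail i (≰⇒> i≰q) i<n) (on-tail i (≰⇒> i≰q))
  ...   | no  _   | inj₂ refl = trans Forth.at-n (trans n∸[q+1]≡k (sym fn≡k))

-- Inversions and fixed points

indicator : ∀ {p} {P : Set p} → Dec P → ℕ
indicator P? = if does P? then 1 else 0

length-filter : ∀ {a p} {A : Set a} {P : Pred A p} (P? : Decidable P) xs →
                length (filter P? xs) ≡ sum (map (λ x → indicator (P? x)) xs)
length-filter P? []       = refl
length-filter P? (x ∷ xs) with does (P? x)
... | true  = cong suc (length-filter P? xs)
... | false = length-filter P? xs

sum-map-concatMap : ∀ {a b} {A : Set a} {B : Set b} (g : B → ℕ) (k : A → List B) xs →
                    sum (map g (concatMap k xs)) ≡ sum (map (λ x → sum (map g (k x))) xs)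
sum-map-concatMap g k []       = refl
sum-map-concatMap g k (x ∷ xs) = begin
  sum (map g (k x ++ concatMap k xs))                   ≡⟨ cong sum (map-++ g (k x) (concatMap k xs)) ⟩
  sum (map g (k x) ++ map g (concatMap k xs))           ≡⟨ sum-++ (map g (k x)) _ ⟩
  sum (map g (k x)) + sum (map g (concatMap k xs))      ≡⟨ cong (sum (map g (k x)) +_) (sum-map-concatMap g k xs) ⟩
  sum (map g (k x)) + sum (map (λ x → sum (map g (k x))) xs) ∎
  where open ≡-Reasoning

sum-map-tabulate : ∀ {a} {A : Set a} m (g : A → ℕ) (h : Fin m → A) → sum (map g (List.tabulate h)) ≡ ∑[ i < m ] g (h i)
sum-map-tabulate zero    g h = refl
sum-map-tabulate (suc m) g h = cong (g (h F.zero) +_) (sum-map-tabulate m g (h ∘′ F.suc))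

inversions : ∀ {a m} → Vec (Fin a) m → ℕ
inversions {m = m} π = length (filter (λ (p : Fin m × Fin m) → let (i , j) = p in (i F.<? j) ×-dec (lookup π j F.<? lookup π i))
                                      (concatMap (λ i → map (i ,_) (allFin m)) (allFin m)))

isInversion : ∀ {a m} → Vec (Fin a) m → Fin m → Fin m → ℕ
isInversion π i j = indicator ((i F.<? j) ×-dec (lookup π j F.<? lookup π i))

inversions-∑ : ∀ {a m} (π : Vec (Fin a) m) → inversions π ≡ ∑[ i < m ] ∑[ j < m ] isInversion π i j
inversions-∑ {m = m} π = begin
  inversions π
    ≡⟨ length-filter inversion? (concatMap pairsFrom (allFin m)) ⟩
  sum (map (λ p → indicator (inversion? p)) (concatMap pairsFrom (allFin m)))
    ≡⟨ sum-map-concatMap _ pairsFrom (allFin m) ⟩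
  sum (map (λ i → sum (map (λ p → indicator (inversion? p)) (pairsFrom i))) (allFin m))
    ≡⟨ sum-map-tabulate m _ id ⟩
  ∑[ i < m ] sum (map (λ p → indicator (inversion? p)) (pairsFrom i))
    ≡⟨ sum-cong-≗ {m} row ⟩
  ∑[ i < m ] ∑[ j < m ] isInversion π i j ∎
  where
  open ≡-Reasoning
  pairsFrom : Fin m → List (Fin m × Fin m)
  pairsFrom i = map (i ,_) (allFin m)
  inversion? : (p : Fin m × Fin m) → Dec _
  inversion? (i , j) = (i F.<? j) ×-dec (lookup π j F.<? lookup π i)
  row : ∀ i → sum (map (λ p → indicator (inversion? p)) (pairsFrom i)) ≡ ∑[ j < m ] isInversion π i j
  row i = trans (cong sum (sym (map-∘ (allFin m)))) (sum-map-tabulate m (λ j → indicator (inversion? (i , j))) id)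

countBelow : ℕ → List ℕ → ℕ
countBelow x []       = 0
countBelow x (y ∷ ys) = indicator (y <? x) + countBelow x ys

listInversions : List ℕ → ℕ
listInversions []       = 0
listInversions (x ∷ xs) = countBelow x xs + listInversions xs

values : ∀ {a m} → Vec (Fin a) m → List ℕ
values v = map toℕ (toList v)

countBelow-∑ : ∀ {a m} (x : Fin a) (v : Vec (Fin a) m) → countBelow (toℕ x) (values v) ≡ ∑[ j < m ] indicator (lookup v j F.<? x)
countBelow-∑ x []      = refl
countBelow-∑ x (y ∷ v) = cong (indicator (toℕ y <? toℕ x) +_) (countBelow-∑ x v)

inversions-∷ : ∀ {a m} (x : Fin a) (v : Vec (Fin a) m) → inversions (x ∷ v) ≡ countBelow (toℕ x) (values v) + inversions v
inversions-∷ {m = m} x v = begin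
  inversions (x ∷ v)
    ≡⟨ inversions-∑ (x ∷ v) ⟩
  ∑[ j < m ] isInversion (x ∷ v) F.zero (F.suc j) + ∑[ i < m ] ∑[ j < m ] isInversion v i j
    ≡⟨ cong₂ _+_ (sym (countBelow-∑ x v)) (sym (inversions-∑ v)) ⟩
  countBelow (toℕ x) (values v) + inversions v ∎
  where open ≡-Reasoning

inversions≡listInversions : ∀ {a m} (v : Vec (Fin a) m) → inversions v ≡ listInversions (values v)
inversions≡listInversions []      = refl
inversions≡listInversions (x ∷ v) = trans (inversions-∷ x v) (cong (countBelow (toℕ x) (values v) +_) (inversions≡listInversions v))

inv≡listInversions : ∀ {n} (w : Word n) → inv w ≡ listInversions (values w)
inv≡listInversions = inversions≡listInversions

segment : (ℕ → ℕ) → ℕ → ℕ → List ℕ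
segment f a zero    = []
segment f a (suc l) = f a ∷ segment f (suc a) l

segment-++ : ∀ f a l₁ l₂ → segment f a (l₁ + l₂) ≡ segment f a l₁ ++ segment f (a + l₁) l₂
segment-++ f a zero     l₂ = cong (λ b → segment f b l₂) (sym (+-identityʳ a))
segment-++ f a (suc l₁) l₂ =
  cong (f a ∷_) (trans (segment-++ f (suc a) l₁ l₂) (cong (λ b → segment f (suc a) l₁ ++ segment f b l₂) (sym (+-suc a l₁))))

segment-cong : ∀ {f g} a l → (∀ i → a ≤ i → i < a + l → f i ≡ g i) → segment f a l ≡ segment g a l
segment-cong a zero    f≗g = refl
segment-cong a (suc l) f≗g =
  cong₂ _∷_ (f≗g a ≤-refl (m<m+n a z<s))
            (segment-cong (suc a) l (λ i a<i i<a+l → f≗g i (<⇒≤ a<i) (subst (i <_) (sym (+-suc a l)) i<a+l)))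

map-segment : ∀ (h : ℕ → ℕ) f a l → map h (segment f a l) ≡ segment (λ i → h (f i)) a l
map-segment h f a zero    = refl
map-segment h f a (suc l) = cong (h (f a) ∷_) (map-segment h f (suc a) l)

segment-suc : ∀ f a l → segment f (suc a) l ≡ segment (λ i → f (suc i)) a l
segment-suc f a zero    = refl
segment-suc f a (suc l) = cong (f (suc a) ∷_) (segment-suc f (suc a) l)

All-segment : ∀ (P : ℕ → Set) f a l → (∀ i → a ≤ i → i < a + l → P (f i)) → All P (segment f a l)
All-segment P f a zero    _  = []
All-segment P f a (suc l) Pf =
  Pf a ≤-refl (m<m+n a z<s) ∷ All-segment P f (suc a) l (λ i a<i i<a+l → Pf i (<⇒≤ a<i) (subst (i <_) (sym (+-suc a l)) i<a+l))

length-segment : ∀ f a l → length (segment f a l) ≡ l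
length-segment f a zero    = refl
length-segment f a (suc l) = cong suc (length-segment f (suc a) l)

indicator-yes : ∀ {p} {P : Set p} (P? : Dec P) → P → indicator P? ≡ 1
indicator-yes (yes _) _  = refl
indicator-yes (no ¬p) p = ⊥-elim (¬p p)

indicator-no : ∀ {p} {P : Set p} (P? : Dec P) → ¬ P → indicator P? ≡ 0
indicator-no (yes p) ¬p = ⊥-elim (¬p p)
indicator-no (no _)  _  = refl

crossInversions : List ℕ → List ℕ → ℕ
crossInversions []       ys = 0
crossInversions (x ∷ xs) ys = countBelow x ys + crossInversions xs ys

countBelow-++ : ∀ x ys zs → countBelow x (ys ++ zs) ≡ countBelow x ys + countBelow x zs
countBelow-++ x []       zs = refl
countBelow-++ x (y ∷ ys) zs = trans (cong (indicator (y <? x) +_) (countBelow-++ x ys zs)) (sym (+-assoc (indicator (y <? x)) _ _))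

listInversions-++ : ∀ xs ys → listInversions (xs ++ ys) ≡ listInversions xs + crossInversions xs ys + listInversions ys
listInversions-++ []       ys = refl
listInversions-++ (x ∷ xs) ys = trans (cong₂ _+_ (countBelow-++ x xs ys) (listInversions-++ xs ys))
  (shuffle (countBelow x xs) (countBelow x ys) (listInversions xs) (crossInversions xs ys) (listInversions ys))
  where
  shuffle : ∀ a b c d e → (a + b) + (c + d + e) ≡ (a + c) + (b + d) + e
  shuffle = solve-∀

crossInversions-++ʳ : ∀ xs ys zs → crossInversions xs (ys ++ zs) ≡ crossInversions xs ys + crossInversions xs zs
crossInversions-++ʳ []       ys zs = refl
crossInversions-++ʳ (x ∷ xs) ys zs = trans (cong₂ _+_ (countBelow-++ x ys zs) (crossInversions-++ʳ xs ys zs))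
  (shuffle (countBelow x ys) (countBelow x zs) (crossInversions xs ys) (crossInversions xs zs))
  where
  shuffle : ∀ a b c d → (a + b) + (c + d) ≡ (a + c) + (b + d)
  shuffle = solve-∀

countBelow-all< : ∀ x ys → All (_< x) ys → countBelow x ys ≡ length ys
countBelow-all< x []       []             = refl
countBelow-all< x (y ∷ ys) (y<x ∷ ys<x) = cong₂ _+_ (indicator-yes (y <? x) y<x) (countBelow-all< x ys ys<x)

countBelow-all≥ : ∀ x ys → All (x ≤_) ys → countBelow x ys ≡ 0
countBelow-all≥ x []       []             = refl
countBelow-all≥ x (y ∷ ys) (x≤y ∷ x≤ys) = cong₂ _+_ (indicator-no (y <? x) (≤⇒≯ x≤y)) (countBelow-all≥ x ys x≤ys)

crossInversions-all> : ∀ xs ys → All (λ x → All (_< x) ys) xs → crossInversions xs ys ≡ length xs * length ys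
crossInversions-all> []       ys []           = refl
crossInversions-all> (x ∷ xs) ys (ys<x ∷ ys<xs) = cong₂ _+_ (countBelow-all< x ys ys<x) (crossInversions-all> xs ys ys<xs)

crossInversions-separated> : ∀ b xs ys → All (b <_) xs → All (_≤ b) ys → crossInversions xs ys ≡ length xs * length ys
crossInversions-separated> b xs ys b<xs ys≤b = crossInversions-all> xs ys (All.map (λ b<x → All.map (λ y≤b → ≤-<-trans y≤b b<x) ys≤b) b<xs)

crossInversions-separated≤ : ∀ b xs ys → All (_≤ b) xs → All (b ≤_) ys → crossInversions xs ys ≡ 0
crossInversions-separated≤ b []       ys []              _    = refl
crossInversions-separated≤ b (x ∷ xs) ys (x≤b ∷ xs≤b) b≤ys =
  cong₂ _+_ (countBelow-all≥ x ys (All.map (≤-trans x≤b) b≤ys)) (crossInversions-separated≤ b xs ys xs≤b b≤ys)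

countBelow-map-suc : ∀ x ys → countBelow (suc x) (map suc ys) ≡ countBelow x ys
countBelow-map-suc x []       = refl
countBelow-map-suc x (y ∷ ys) = cong (indicator (y <? x) +_) (countBelow-map-suc x ys)

listInversions-map-suc : ∀ xs → listInversions (map suc xs) ≡ listInversions xs
listInversions-map-suc []       = refl
listInversions-map-suc (x ∷ xs) = cong₂ _+_ (countBelow-map-suc x xs) (listInversions-map-suc xs)

isFixed : (ℕ → ℕ) → ℕ → ℕ
isFixed f i = indicator (f i ≟ i)

fixedPoints : ℕ → (ℕ → ℕ) → ℕ
fixedPoints n f = sum (segment (isFixed f) 0 n)

segment-snoc : ∀ f n → segment f 0 (suc n) ≡ segment f 0 n ++ (f n ∷ [])
segment-snoc f n = trans (cong (segment f 0) (+-comm 1 n)) (segment-++ f 0 n 1)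

module _ {n : ℕ} {f : ℕ → ℕ} where

  private
    g : ℕ → ℕ
    g = appendFixedPoint n f

  segment-appendFixedPoint : segment g 0 (suc n) ≡ segment f 0 n ++ (n ∷ [])
  segment-appendFixedPoint = trans (segment-snoc g n)
    (cong₂ _++_ (segment-cong 0 n (λ i _ i<n → ifLt-< i<n)) (cong (_∷ []) (ifLt-≥ (≤-refl {n}))))

  listInversions-appendFixedPoint : Involution132 n f → listInversions (segment g 0 (suc n)) ≡ listInversions (segment f 0 n)
  listInversions-appendFixedPoint I = begin
    listInversions (segment g 0 (suc n))                          ≡⟨ cong listInversions segment-appendFixedPoint ⟩
    listInversions (segment f 0 n ++ (n ∷ []))                    ≡⟨ listInversions-++ (segment f 0 n) (n ∷ []) ⟩
    listInversions (segment f 0 n) + crossInversions (segment f 0 n) (n ∷ []) + 0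
      ≡⟨ cong (λ x → listInversions (segment f 0 n) + x + 0)
           (crossInversions-separated≤ n (segment f 0 n) (n ∷ [])
             (All-segment (_≤ n) f 0 n (λ i _ i<n → <⇒≤ (Involution132.bounded I i i<n))) (≤-refl ∷ [])) ⟩
    listInversions (segment f 0 n) + 0 + 0                        ≡⟨ trans (+-identityʳ _) (+-identityʳ _) ⟩
    listInversions (segment f 0 n)                                ∎
    where open ≡-Reasoning

  fixedPoints-appendFixedPoint : fixedPoints (suc n) g ≡ suc (fixedPoints n f)
  fixedPoints-appendFixedPoint = begin
    sum (segment (isFixed g) 0 (suc n))                  ≡⟨ cong sum (segment-snoc (isFixed g) n) ⟩
    sum (segment (isFixed g) 0 n ++ (isFixed g n ∷ []))  ≡⟨ sum-++ (segment (isFixed g) 0 n) _ ⟩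
    sum (segment (isFixed g) 0 n) + (isFixed g n + 0)
      ≡⟨ cong₂ _+_ (cong sum (segment-cong 0 n (λ i _ i<n → cong (λ x → indicator (x ≟ i)) (ifLt-< i<n))))
                   (cong (_+ 0) (trans (cong (λ x → indicator (x ≟ n)) (ifLt-≥ (≤-refl {n}))) (indicator-yes (n ≟ n) refl))) ⟩
    fixedPoints n f + 1                                  ≡⟨ +-comm _ 1 ⟩
    suc (fixedPoints n f)                                ∎
    where open ≡-Reasoning

module PairUpCounts {n f} (I : Involution132 n f) {q} (M : IsMaxFixedPoint n f q) where

  open Involution132 I
  open IsMaxFixedPoint M
  open PairUp I M

  d : ℕ
  d = q ∸ k

  k+d≡q : k + d ≡ q
  k+d≡q = m+[n∸m]≡n k≤q

  [k+d+1]+k≡n : suc (k + d) + k ≡ n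
  [k+d+1]+k≡n = trans (cong (λ x → suc x + k) k+d≡q) q+1+k≡n

  private
    A Mid A′ restF restG : List ℕ
    A     = segment f 0 k
    Mid   = segment f k d
    A′    = segment f (suc q) k
    restF = Mid ++ (q ∷ A′)
    restG = map suc Mid ++ (A′ ++ (k ∷ []))
    |A| : length A ≡ k
    |A| = length-segment f 0 k
    |Mid| : length Mid ≡ d
    |Mid| = length-segment f k d
    |A′| : length A′ ≡ k
    |A′| = length-segment f (suc q) k

    within-middle : ∀ i → i < k + d → suc i ≤ q
    within-middle i i<k+d = subst (suc i ≤_) k+d≡q i<k+d

    A>q : All (q <_) A
    A>q = All-segment (q <_) f 0 k (λ i _ i<k → head→tail i i<k)
    A≤n : All (_≤ n) A
    A≤n = All-segment (_≤ n) f 0 k (λ i _ i<k → <⇒≤ (bounded i (<-trans i<k k<n)))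
    Mid<q : All (_< q) Mid
    Mid<q = All-segment (_< q) f k d (λ i k≤i i<k+d → proj₂ (middle→middle i k≤i (within-middle i i<k+d)))
    Mid≥k : All (k ≤_) Mid
    Mid≥k = All-segment (k ≤_) f k d (λ i k≤i i<k+d → proj₁ (middle→middle i k≤i (within-middle i i<k+d)))
    A′<k : All (_< k) A′
    A′<k = All-segment (_< k) f (suc q) k (λ i q<i i<n → tail→head i q<i (subst (i <_) q+1+k≡n i<n))
    restG≤q : All (_≤ q) restG
    restG≤q = Allₚ.++⁺ (Allₚ.map⁺ Mid<q) (Allₚ.++⁺ (All.map (λ x<k → ≤-trans (<⇒≤ x<k) k≤q) A′<k) (k≤q ∷ []))
    restF≤q : All (_≤ q) restF
    restF≤q = Allₚ.++⁺ (All.map <⇒≤ Mid<q) (≤-refl ∷ All.map (λ x<k → ≤-trans (<⇒≤ x<k) k≤q) A′<k)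
    |restG| : length restG ≡ d + (k + 1)
    |restG| = trans (length-++ (map suc Mid)) (cong₂ _+_ (trans (length-map suc Mid) |Mid|) (trans (length-++ A′) (cong (_+ 1) |A′|)))
    |restF| : length restF ≡ d + suc k
    |restF| = trans (length-++ Mid) (cong₂ _+_ |Mid| (cong suc |A′|))

  private
    split-n : ∀ F → segment F 0 n ≡ segment F 0 k ++ (segment F k d ++ (F q ∷ segment F (suc q) k))
    split-n F = begin
      segment F 0 n                                    ≡⟨ cong (segment F 0) (trans (sym [k+d+1]+k≡n) (shape k d)) ⟩
      segment F 0 (k + (d + suc k))                    ≡⟨ segment-++ F 0 k (d + suc k) ⟩
      segment F 0 k ++ segment F k (d + suc k)         ≡⟨ cong (segment F 0 k ++_) (segment-++ F k d (suc k)) ⟩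
      segment F 0 k ++ (segment F k d ++ (F (k + d) ∷ segment F (suc (k + d)) k))
        ≡⟨ cong (λ x → segment F 0 k ++ (segment F k d ++ (F x ∷ segment F (suc x) k))) k+d≡q ⟩
      segment F 0 k ++ (segment F k d ++ (F q ∷ segment F (suc q) k)) ∎
      where
      open ≡-Reasoning
      shape : ∀ k d → suc (k + d) + k ≡ k + (d + suc k)
      shape = solve-∀

    split-n+1 : ∀ F → segment F 0 (suc n) ≡ segment F 0 k ++ (F k ∷ (segment F (suc k) d ++ (segment F (suc q) k ++ (F n ∷ []))))
    split-n+1 F = begin
      segment F 0 (suc n)
        ≡⟨ cong (segment F 0) (trans (cong suc (sym [k+d+1]+k≡n)) (shape k d)) ⟩
      segment F 0 (k + suc (d + (k + 1)))
        ≡⟨ segment-++ F 0 k _ ⟩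
      segment F 0 k ++ (F k ∷ segment F (suc k) (d + (k + 1)))
        ≡⟨ cong (λ x → segment F 0 k ++ (F k ∷ x)) (segment-++ F (suc k) d (k + 1)) ⟩
      segment F 0 k ++ (F k ∷ (segment F (suc k) d ++ segment F (suc (k + d)) (k + 1)))
        ≡⟨ cong (λ x → segment F 0 k ++ (F k ∷ (segment F (suc k) d ++ x))) (segment-++ F (suc (k + d)) k 1) ⟩
      segment F 0 k ++ (F k ∷ (segment F (suc k) d ++ (segment F (suc (k + d)) k ++ (F (suc (k + d) + k) ∷ []))))
        ≡⟨ cong₂ (λ x y → segment F 0 k ++ (F k ∷ (segment F (suc k) d ++ (segment F (suc x) k ++ (F y ∷ []))))) k+d≡q [k+d+1]+k≡n ⟩
      segment F 0 k ++ (F k ∷ (segment F (suc k) d ++ (segment F (suc q) k ++ (F n ∷ [])))) ∎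
      where
      open ≡-Reasoning
      shape : ∀ k d → suc (suc (k + d) + k) ≡ k + suc (d + (k + 1))
      shape = solve-∀

  segment-f : segment f 0 n ≡ A ++ (Mid ++ (q ∷ A′))
  segment-f = trans (split-n f) (cong (λ x → A ++ (Mid ++ (x ∷ A′))) fixed)

  private
    segment-g-middle : segment g (suc k) d ≡ map suc Mid
    segment-g-middle = begin
      segment g (suc k) d                   ≡⟨ segment-suc g k d ⟩
      segment (λ i → g (suc i)) k d         ≡⟨ segment-cong k d (λ i k≤i i<k+d → on-middle (suc i) (s≤s k≤i) (within-middle i i<k+d)) ⟩
      segment (λ i → suc (f i)) k d         ≡⟨ sym (map-segment suc f k d) ⟩
      map suc Mid                            ∎
      where open ≡-Reasoning

    segment-g-tail : segment g (suc q) k ≡ A′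
    segment-g-tail = segment-cong (suc q) k (λ i q<i i<q+1+k → on-tail i q<i (subst (i <_) q+1+k≡n i<q+1+k))

  segment-g : segment g 0 (suc n) ≡ A ++ (n ∷ restG)
  segment-g = begin
    segment g 0 (suc n)                                                          ≡⟨ split-n+1 g ⟩
    segment g 0 k ++ (g k ∷ (segment g (suc k) d ++ (segment g (suc q) k ++ (g n ∷ []))))
      ≡⟨ cong₂ (λ x y → x ++ (y ∷ (segment g (suc k) d ++ (segment g (suc q) k ++ (g n ∷ []))))) (segment-cong 0 k (λ i _ i<k → on-head i i<k)) at-k ⟩
    A ++ (n ∷ (segment g (suc k) d ++ (segment g (suc q) k ++ (g n ∷ []))))
      ≡⟨ cong₂ (λ x y → A ++ (n ∷ (x ++ y))) segment-g-middle (cong₂ (λ x y → x ++ (y ∷ [])) segment-g-tail at-n) ⟩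
    A ++ (n ∷ restG)                                                                 ∎
    where open ≡-Reasoning

  listInversions-f : listInversions (segment f 0 n) ≡
    listInversions A + k * (d + suc k) + (listInversions Mid + (0 + d * k) + (k + listInversions A′))
  listInversions-f = begin
    listInversions (segment f 0 n)                              ≡⟨ cong listInversions segment-f ⟩
    listInversions (A ++ restF)                                     ≡⟨ listInversions-++ A restF ⟩
    listInversions A + crossInversions A restF + listInversions restF
      ≡⟨ cong₂ (λ x y → listInversions A + x + y)
           (trans (crossInversions-separated> q A restF A>q restF≤q) (cong₂ _*_ |A| |restF|))
           (listInversions-++ Mid (q ∷ A′)) ⟩
    listInversions A + k * (d + suc k) + (listInversions Mid + crossInversions Mid (q ∷ A′) + listInversions (q ∷ A′))
      ≡⟨ cong₂ (λ x y → listInversions A + k * (d + suc k) + (listInversions Mid + x + y))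
           (trans (crossInversions-++ʳ Mid (q ∷ []) A′)
             (cong₂ _+_ (crossInversions-separated≤ q Mid (q ∷ []) (All.map <⇒≤ Mid<q) (≤-refl ∷ []))
                        (trans (crossInversions-all> Mid A′ (All.map (λ k≤x → All.map (λ y<k → <-≤-trans y<k k≤x) A′<k) Mid≥k))
                               (cong₂ _*_ |Mid| |A′|))))
           (cong (_+ listInversions A′) (trans (countBelow-all< q A′ (All.map (λ y<k → <-≤-trans y<k k≤q) A′<k)) |A′|)) ⟩
    listInversions A + k * (d + suc k) + (listInversions Mid + (0 + d * k) + (k + listInversions A′)) ∎
    where open ≡-Reasoning

  listInversions-g : listInversions (segment g 0 (suc n)) ≡
    listInversions A + (0 + k * (d + (k + 1))) + ((d + (k + 1)) + (listInversions Mid + d * (k + 1) + (listInversions A′ + 0 + 0)))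
  listInversions-g = begin
    listInversions (segment g 0 (suc n))                            ≡⟨ cong listInversions segment-g ⟩
    listInversions (A ++ (n ∷ restG))                                   ≡⟨ listInversions-++ A (n ∷ restG) ⟩
    listInversions A + crossInversions A (n ∷ restG) + (countBelow n restG + listInversions restG)
      ≡⟨ cong₂ (λ x y → listInversions A + x + y)
           (trans (crossInversions-++ʳ A (n ∷ []) restG)
             (cong₂ _+_ (crossInversions-separated≤ n A (n ∷ []) A≤n (≤-refl ∷ []))
                        (trans (crossInversions-separated> q A restG A>q restG≤q) (cong₂ _*_ |A| |restG|))))
           (cong₂ _+_ (trans (countBelow-all< n restG (All.map (λ x≤q → ≤-<-trans x≤q q<n) restG≤q)) |restG|)
                      (listInversions-++ (map suc Mid) (A′ ++ (k ∷ [])))) ⟩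
    listInversions A + (0 + k * (d + (k + 1))) + ((d + (k + 1)) +
      (listInversions (map suc Mid) + crossInversions (map suc Mid) (A′ ++ (k ∷ [])) + listInversions (A′ ++ (k ∷ []))))
      ≡⟨ cong (λ x → listInversions A + (0 + k * (d + (k + 1))) + ((d + (k + 1)) + x)) (cong₂ _+_ (cong₂ _+_
           (listInversions-map-suc Mid)
           (trans (crossInversions-separated> k (map suc Mid) (A′ ++ (k ∷ []))
                    (Allₚ.map⁺ (All.map s≤s Mid≥k)) (Allₚ.++⁺ (All.map <⇒≤ A′<k) (≤-refl ∷ [])))
                  (cong₂ _*_ (trans (length-map suc Mid) |Mid|) (trans (length-++ A′) (cong (_+ 1) |A′|)))))
           (trans (listInversions-++ A′ (k ∷ []))
                  (cong (λ x → listInversions A′ + x + 0) (crossInversions-separated≤ k A′ (k ∷ []) (All.map <⇒≤ A′<k) (≤-refl ∷ []))))) ⟩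
    listInversions A + (0 + k * (d + (k + 1))) + ((d + (k + 1)) + (listInversions Mid + d * (k + 1) + (listInversions A′ + 0 + 0))) ∎
    where open ≡-Reasoning

  listInversions-pairUp : listInversions (segment g 0 (suc n)) ≡ suc (listInversions (segment f 0 n)) + d * 2
  listInversions-pairUp = trans listInversions-g
    (trans (collect (listInversions A) (listInversions Mid) (listInversions A′) k d) (cong (λ x → suc x + d * 2) (sym listInversions-f)))
    where
    collect : ∀ a m a′ k d → a + (0 + k * (d + (k + 1))) + ((d + (k + 1)) + (m + d * (k + 1) + (a′ + 0 + 0)))
                           ≡ suc (a + k * (d + suc k) + (m + (0 + d * k) + (k + a′))) + d * 2
    collect = solve-∀

  private
    Fh Fm Ft : List ℕ
    Fh = segment (isFixed f) 0 k
    Fm = segment (isFixed f) k d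
    Ft = segment (isFixed f) (suc q) k

    fixed-f : segment (isFixed f) 0 n ≡ Fh ++ (Fm ++ (1 ∷ Ft))
    fixed-f = trans (split-n (isFixed f)) (cong (λ x → Fh ++ (Fm ++ (x ∷ Ft))) (indicator-yes (f q ≟ q) fixed))

    fixed-g : segment (isFixed g) 0 (suc n) ≡ Fh ++ (0 ∷ (Fm ++ (Ft ++ (0 ∷ []))))
    fixed-g = begin
      segment (isFixed g) 0 (suc n)
        ≡⟨ split-n+1 (isFixed g) ⟩
      segment (isFixed g) 0 k ++ (isFixed g k ∷ (segment (isFixed g) (suc k) d ++ (segment (isFixed g) (suc q) k ++ (isFixed g n ∷ []))))
        ≡⟨ cong₂ (λ x y → x ++ (y ∷ (segment (isFixed g) (suc k) d ++ (segment (isFixed g) (suc q) k ++ (isFixed g n ∷ [])))))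
                 on-head-block k-not-fixed ⟩
      Fh ++ (0 ∷ (segment (isFixed g) (suc k) d ++ (segment (isFixed g) (suc q) k ++ (isFixed g n ∷ []))))
        ≡⟨ cong₂ (λ x y → Fh ++ (0 ∷ (x ++ y))) on-middle-block (cong₂ (λ x y → x ++ (y ∷ [])) on-tail-block n-not-fixed) ⟩
      Fh ++ (0 ∷ (Fm ++ (Ft ++ (0 ∷ []))))
        ∎
      where
      open ≡-Reasoning
      on-head-block : segment (isFixed g) 0 k ≡ Fh
      on-head-block = segment-cong 0 k (λ i _ i<k → cong (λ x → indicator (x ≟ i)) (on-head i i<k))
      on-middle-block : segment (isFixed g) (suc k) d ≡ Fm
      on-middle-block = trans (segment-suc (isFixed g) k d) (segment-cong k d (λ i k≤i i<k+d →
                 cong (λ x → indicator (x ≟ suc i)) (on-middle (suc i) (s≤s k≤i) (within-middle i i<k+d))))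
      on-tail-block : segment (isFixed g) (suc q) k ≡ Ft
      on-tail-block = segment-cong (suc q) k (λ i q<i i<q+1+k → cong (λ x → indicator (x ≟ i)) (on-tail i q<i (subst (i <_) q+1+k≡n i<q+1+k)))
      k-not-fixed : isFixed g k ≡ 0
      k-not-fixed = trans (cong (λ x → indicator (x ≟ k)) at-k) (indicator-no (n ≟ k) (≢-sym (<⇒≢ k<n)))
      n-not-fixed : isFixed g n ≡ 0
      n-not-fixed = trans (cong (λ x → indicator (x ≟ n)) at-n) (indicator-no (k ≟ n) (<⇒≢ k<n))

  fixedPoints-pairUp : fixedPoints n f ≡ suc (fixedPoints (suc n) g)
  fixedPoints-pairUp = begin
    sum (segment (isFixed f) 0 n)                       ≡⟨ cong sum fixed-f ⟩
    sum (Fh ++ (Fm ++ (1 ∷ Ft)))                        ≡⟨ trans (sum-++ Fh _) (cong (sum Fh +_) (sum-++ Fm _)) ⟩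
    sum Fh + (sum Fm + (1 + sum Ft))                    ≡⟨ collect (sum Fh) (sum Fm) (sum Ft) ⟩
    suc (sum Fh + (0 + (sum Fm + (sum Ft + (0 + 0)))))
      ≡⟨ cong (λ x → suc (sum Fh + (0 + x))) (sym (trans (sum-++ Fm _) (cong (sum Fm +_) (sum-++ Ft _)))) ⟩
    suc (sum Fh + (0 + sum (Fm ++ (Ft ++ (0 ∷ [])))))   ≡⟨ cong suc (sym (sum-++ Fh _)) ⟩
    suc (sum (Fh ++ (0 ∷ (Fm ++ (Ft ++ (0 ∷ []))))))    ≡⟨ cong (suc ∘ sum) (sym fixed-g) ⟩
    suc (sum (segment (isFixed g) 0 (suc n)))           ∎
    where
    open ≡-Reasoning
    collect : ∀ a m a′ → a + (m + (1 + a′)) ≡ suc (a + (0 + (m + (a′ + (0 + 0)))))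
    collect = solve-∀

values≡segment : ∀ {a m} (v : Vec (Fin a) m) → values v ≡ segment (at v) 0 m
values≡segment []      = refl
values≡segment (x ∷ v) = cong (toℕ x ∷_) (trans (values≡segment v) (sym (segment-suc (at (x ∷ v)) 0 _)))

inv-fromFunction : ∀ {n f} → Involution132 n f → inv (fromFunction n f) ≡ listInversions (segment f 0 n)
inv-fromFunction {n} {f} I = begin
  inv (fromFunction n f)                                   ≡⟨ inv≡listInversions (fromFunction n f) ⟩
  listInversions (values (fromFunction n f))               ≡⟨ cong listInversions (values≡segment (fromFunction n f)) ⟩
  listInversions (segment (at (fromFunction n f)) 0 n)
    ≡⟨ cong listInversions (segment-cong 0 n (λ i _ i<n → at-fromFunction-Involution132 I i i<n)) ⟩
  listInversions (segment f 0 n)                           ∎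
  where open ≡-Reasoning

fixedPoints-fromFunction : ∀ {n f} → Involution132 n f → fixedPoints n (at (fromFunction n f)) ≡ fixedPoints n f
fixedPoints-fromFunction I = cong sum (segment-cong 0 _ (λ i _ i<n → cong (λ x → indicator (x ≟ i)) (at-fromFunction-Involution132 I i i<n)))

appendFixedPointʷ : ∀ {n} → Word n → Word (suc n)
appendFixedPointʷ {n} w = fromFunction (suc n) (appendFixedPoint n (at w))

pairUpʷ : ∀ {n} → Word n → Word (suc n)
pairUpʷ {n} w = fromFunction (suc n) (pairUp n (maxFixedPoint n (at w)) (at w))

unpairʷ : ∀ {n} → Word (suc n) → Word n
unpairʷ {n} w = fromFunction n (unpair n (at w n) (at w))

initʷ : ∀ {n} → Word (suc n) → Word n
initʷ {n} w = fromFunction n (at w)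

module AppendFixedPointʷ {n} (w : Word n) (valid : Is132AvoidingInvolution w) where

  private
    I : Involution132 n (at w)
    I = word⇒Involution132 w valid
    I′ : Involution132 (suc n) (appendFixedPoint n (at w))
    I′ = appendFixedPoint-Involution132 I

  is132AvoidingInvolution : Is132AvoidingInvolution (appendFixedPointʷ w)
  is132AvoidingInvolution = fromFunction-132AvoidingInvolution I′

  fixedPoints-suc : fixedPoints (suc n) (at (appendFixedPointʷ w)) ≡ suc (fixedPoints n (at w))
  fixedPoints-suc = trans (fixedPoints-fromFunction I′) fixedPoints-appendFixedPoint

  inv-preserved : inv (appendFixedPointʷ w) ≡ inv w
  inv-preserved = begin
    inv (appendFixedPointʷ w)                                       ≡⟨ inv-fromFunction I′ ⟩
    listInversions (segment (appendFixedPoint n (at w)) 0 (suc n))  ≡⟨ listInversions-appendFixedPoint I ⟩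
    listInversions (segment (at w) 0 n)                             ≡⟨ cong listInversions (sym (values≡segment w)) ⟩
    listInversions (values w)                                       ≡⟨ sym (inv≡listInversions w) ⟩
    inv w                                                           ∎
    where open ≡-Reasoning

module PairUpʷ {n} (w : Word n) (valid : Is132AvoidingInvolution w) (hasFixedPoint : HasFixedPoint n (at w)) where

  private
    I : Involution132 n (at w)
    I = word⇒Involution132 w valid
    M : IsMaxFixedPoint n (at w) (maxFixedPoint n (at w))
    M = maxFixedPoint-isMax n (at w) hasFixedPoint
    open PairUp I M using (g; involution132; k; k<n; at-n; unpair-pairUp)
    open PairUpCounts I M using (d; listInversions-pairUp; fixedPoints-pairUp)

  is132AvoidingInvolution : Is132AvoidingInvolution (pairUpʷ w)
  is132AvoidingInvolution = fromFunction-132AvoidingInvolution involution132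

  fixedPoints-pred : fixedPoints n (at w) ≡ suc (fixedPoints (suc n) (at (pairUpʷ w)))
  fixedPoints-pred = trans fixedPoints-pairUp (cong suc (sym (fixedPoints-fromFunction involution132)))

  inv-suc+even : inv (pairUpʷ w) ≡ suc (inv w) + d * 2
  inv-suc+even = begin
    inv (pairUpʷ w)                                  ≡⟨ inv-fromFunction involution132 ⟩
    listInversions (segment g 0 (suc n))             ≡⟨ listInversions-pairUp ⟩
    suc (listInversions (segment (at w) 0 n)) + d * 2 ≡⟨ cong (λ x → suc (listInversions x) + d * 2) (sym (values≡segment w)) ⟩
    suc (listInversions (values w)) + d * 2          ≡⟨ cong (λ x → suc x + d * 2) (sym (inv≡listInversions w)) ⟩
    suc (inv w) + d * 2                              ∎
    where open ≡-Reasoning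

  inv-parity-flips : inv (pairUpʷ w) % 2 ≡ suc (inv w) % 2
  inv-parity-flips = trans (cong (_% 2) inv-suc+even) ([m+kn]%n≡m%n (suc (inv w)) d 2)

  last<n : at (pairUpʷ w) n < n
  last<n = subst (_< n) (sym (trans (at-fromFunction-Involution132 involution132 n (n<1+n n)) at-n)) k<n

  unpairʷ-pairUpʷ : unpairʷ (pairUpʷ w) ≡ w
  unpairʷ-pairUpʷ = at-injective (unpairʷ (pairUpʷ w)) w agree
    where
    G : ℕ → ℕ
    G = at (pairUpʷ w)
    G≗g : ∀ i → i < suc n → G i ≡ g i
    G≗g = at-fromFunction-Involution132 involution132
    back : Involution132 n (unpair n (G n) G)
    back = Unpair.involution132 (fromFunction-Involution132 involution132) refl last<n
    agree : ∀ i → i < n → at (unpairʷ (pairUpʷ w)) i ≡ at w i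
    agree i i<n = begin
      at (unpairʷ (pairUpʷ w)) i  ≡⟨ at-fromFunction-Involution132 back i i<n ⟩
      unpair n (G n) G i          ≡⟨ unpair-cong n (G n) (λ j j≤n → G≗g j (s≤s j≤n)) i i<n ⟩
      unpair n (G n) g i          ≡⟨ cong (λ x → unpair n x g i) (G≗g n (n<1+n n)) ⟩
      unpair n (g n) g i          ≡⟨ unpair-pairUp i i<n ⟩
      at w i                      ∎
      where open ≡-Reasoning

at-appendFixedPointʷ : ∀ {n} (v : Word n) i → i < n → at (appendFixedPointʷ v) i ≡ at v i
at-appendFixedPointʷ {n} v i i<n =
  trans (at-fromFunction (suc n) (appendFixedPoint n (at v)) i (m<n⇒m<1+n i<n)
          (subst (_< suc n) (sym (ifLt-< i<n)) (m<n⇒m<1+n (at-bounded v i i<n))))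
        (ifLt-< i<n)

at-appendFixedPointʷ-last : ∀ {n} (v : Word n) → at (appendFixedPointʷ v) n ≡ n
at-appendFixedPointʷ-last {n} v =
  trans (at-fromFunction (suc n) (appendFixedPoint n (at v)) n (n<1+n n) (subst (_< suc n) (sym (ifLt-≥ (≤-refl {n}))) (n<1+n n)))
        (ifLt-≥ (≤-refl {n}))

appendFixedPointʷ-injective : ∀ {n} (v w : Word n) → appendFixedPointʷ v ≡ appendFixedPointʷ w → v ≡ w
appendFixedPointʷ-injective v w Uv≡Uw = at-injective v w (λ i i<n →
  trans (sym (at-appendFixedPointʷ v i i<n)) (trans (cong (λ u → at u i) Uv≡Uw) (at-appendFixedPointʷ w i i<n)))

appendFixedPointʷ≢pairUpʷ : ∀ {n} (v w : Word n) → Is132AvoidingInvolution w → HasFixedPoint n (at w) → appendFixedPointʷ v ≢ pairUpʷ w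
appendFixedPointʷ≢pairUpʷ {n} v w valid hasFixedPoint Uv≡Dw =
  <-irrefl (sym (trans (sym (at-appendFixedPointʷ-last v)) (cong (λ u → at u n) Uv≡Dw))) (PairUpʷ.last<n w valid hasFixedPoint)

module Initʷ {n} (w : Word (suc n)) (valid : Is132AvoidingInvolution w) (last-fixed : at w n ≡ n) where

  private
    I : Involution132 n (at w)
    I = Involution132-init (word⇒Involution132 w valid) last-fixed

  is132AvoidingInvolution : Is132AvoidingInvolution (initʷ w)
  is132AvoidingInvolution = fromFunction-132AvoidingInvolution I

  appendFixedPointʷ-initʷ : appendFixedPointʷ (initʷ w) ≡ w
  appendFixedPointʷ-initʷ = at-injective (appendFixedPointʷ (initʷ w)) w agree
    where
    agree : ∀ i → i < suc n → at (appendFixedPointʷ (initʷ w)) i ≡ at w i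
    agree i i<n+1 with m≤n⇒m<n∨m≡n (≤-pred i<n+1)
    ... | inj₁ i<n  = trans (at-appendFixedPointʷ (initʷ w) i i<n) (at-fromFunction-Involution132 I i i<n)
    ... | inj₂ refl = trans (at-appendFixedPointʷ-last (initʷ w)) (sym last-fixed)

module Unpairʷ {n} (w : Word (suc n)) (valid : Is132AvoidingInvolution w) (last-not-fixed : at w n ≢ n) where

  private
    I : Involution132 (suc n) (at w)
    I = word⇒Involution132 w valid
    k<n : at w n < n
    k<n = ≤∧≢⇒< (≤-pred (Involution132.bounded I n (n<1+n n))) last-not-fixed
    open Unpair I refl k<n using (g; q; q<n; at-q; involution132; isMaxFixedPoint; pairUp-unpair)
    G : ℕ → ℕ
    G = at (unpairʷ w)
    G≗g : ∀ i → i < n → G i ≡ g i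
    G≗g = at-fromFunction-Involution132 involution132

  is132AvoidingInvolution : Is132AvoidingInvolution (unpairʷ w)
  is132AvoidingInvolution = fromFunction-132AvoidingInvolution involution132

  hasFixedPoint : HasFixedPoint n G
  hasFixedPoint = q , q<n , trans (G≗g q q<n) at-q

  pairUpʷ-unpairʷ : pairUpʷ (unpairʷ w) ≡ w
  pairUpʷ-unpairʷ = at-injective (pairUpʷ (unpairʷ w)) w agree
    where
    maxFixedPoint≡q : maxFixedPoint n G ≡ q
    maxFixedPoint≡q = trans (maxFixedPoint-cong n G≗g) (maxFixedPoint-unique n g q isMaxFixedPoint)
    forth : Involution132 (suc n) (pairUp n (maxFixedPoint n G) G)
    forth = PairUp.involution132 (fromFunction-Involution132 involution132) (maxFixedPoint-isMax n G hasFixedPoint)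
    agree : ∀ i → i < suc n → at (pairUpʷ (unpairʷ w)) i ≡ at w i
    agree i i<n+1 = begin
      at (pairUpʷ (unpairʷ w)) i      ≡⟨ at-fromFunction-Involution132 forth i i<n+1 ⟩
      pairUp n (maxFixedPoint n G) G i ≡⟨ cong (λ x → pairUp n x G i) maxFixedPoint≡q ⟩
      pairUp n q G i                   ≡⟨ pairUp-cong n q q<n G≗g i ⟩
      pairUp n q g i                   ≡⟨ pairUp-unpair i (≤-pred i<n+1) ⟩
      at w i                           ∎
      where open ≡-Reasoning

fixedPoint⇒0<sum : ∀ f a l j → a ≤ j → j < a + l → f j ≡ j → 0 < sum (segment (isFixed f) a l)
fixedPoint⇒0<sum f a zero    j a≤j j<a+0 _ = ⊥-elim (<⇒≱ j<a+0 (subst (_≤ j) (sym (+-identityʳ a)) a≤j))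
fixedPoint⇒0<sum f a (suc l) j a≤j j<a+l+1 fj≡j with f a ≟ a | m≤n⇒m<n∨m≡n a≤j
... | yes fa≡a | _         = subst (λ x → 0 < x + sum (segment (isFixed f) (suc a) l)) (sym (indicator-yes (f a ≟ a) fa≡a)) (s≤s z≤n)
... | no  fa≢a | inj₂ refl = ⊥-elim (fa≢a fj≡j)
... | no  fa≢a | inj₁ a<j  = subst (λ x → 0 < x + sum (segment (isFixed f) (suc a) l)) (sym (indicator-no (f a ≟ a) fa≢a))
                               (fixedPoint⇒0<sum f (suc a) l j a<j (subst (j <_) (+-suc a l) j<a+l+1) fj≡j)

0<sum⇒fixedPoint : ∀ f a l → 0 < sum (segment (isFixed f) a l) → Σ ℕ λ j → a ≤ j × j < a + l × f j ≡ j
0<sum⇒fixedPoint f a (suc l) 0<sum with f a ≟ a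
... | yes fa≡a = a , ≤-refl , m<m+n a z<s , fa≡a
... | no  fa≢a with 0<sum⇒fixedPoint f (suc a) l (subst (λ x → 0 < x + sum (segment (isFixed f) (suc a) l)) (indicator-no (f a ≟ a) fa≢a) 0<sum)
...   | j , a<j , j<a+1+l , fj≡j = j , <⇒≤ a<j , subst (j <_) (sym (+-suc a l)) j<a+1+l , fj≡j

0<fixedPoints⇒HasFixedPoint : ∀ n f → 0 < fixedPoints n f → HasFixedPoint n f
0<fixedPoints⇒HasFixedPoint n f 0<fp with 0<sum⇒fixedPoint f 0 n 0<fp
... | j , _ , j<n , fj≡j = j , j<n , fj≡j

HasFixedPoint⇒0<fixedPoints : ∀ n f → HasFixedPoint n f → 0 < fixedPoints n f
HasFixedPoint⇒0<fixedPoints n f (j , j<n , fj≡j) = fixedPoint⇒0<sum f 0 n j z≤n j<n fj≡j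

-- Enumeration by the number of two-cycles

-- The 132-avoiding involutions of [n] with c two-cycles, grown from those of [n - 1]
-- by appending a fixed point or, if there is a fixed point to spare, by pairing up.
involutionsWith : (n c : ℕ) → List (Word n)
involutionsWith zero    zero    = [] ∷ []
involutionsWith zero    (suc c) = []
involutionsWith (suc n) zero    = map appendFixedPointʷ (involutionsWith n zero)
involutionsWith (suc n) (suc c) =
  map appendFixedPointʷ (involutionsWith n (suc c)) ++ (if c + c <ᵇ n then map pairUpʷ (involutionsWith n c) else [])

length-involutionsWith : ∀ n c → length (involutionsWith n c) ≡ ballot n c
length-involutionsWith zero    zero    = refl
length-involutionsWith zero    (suc c) = refl
length-involutionsWith (suc n) zero    = trans (length-map appendFixedPointʷ (involutionsWith n zero)) (length-involutionsWith n zero)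
length-involutionsWith (suc n) (suc c) with c + c <ᵇ n
... | true  = trans (length-++ (map appendFixedPointʷ (involutionsWith n (suc c))) {map pairUpʷ (involutionsWith n c)})
                (cong₂ _+_ (trans (length-map appendFixedPointʷ (involutionsWith n (suc c))) (length-involutionsWith n (suc c)))
                           (trans (length-map pairUpʷ (involutionsWith n c)) (length-involutionsWith n c)))
... | false = trans (length-++ (map appendFixedPointʷ (involutionsWith n (suc c))) {[]})
                (cong (_+ 0) (trans (length-map appendFixedPointʷ (involutionsWith n (suc c))) (length-involutionsWith n (suc c))))

record InvolutionWith (n c : ℕ) (w : Word n) : Set where
  field
    valid       : Is132AvoidingInvolution w
    twoCycles   : fixedPoints n (at w) + (c + c) ≡ n
    inv-parity  : inv w % 2 ≡ c % 2

  hasFixedPoint : c + c < n → HasFixedPoint n (at w)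
  hasFixedPoint 2c<n = 0<fixedPoints⇒HasFixedPoint n (at w)
    (≤∧≢⇒< z≤n (λ 0≡fp → <⇒≢ 2c<n (trans (cong (_+ (c + c)) 0≡fp) twoCycles)))

InvolutionWith-empty : InvolutionWith 0 0 []
InvolutionWith-empty = record
  { valid = Involution132⇒word [] (record { bounded = λ _ () ; involutive = λ _ () ; avoids132 = λ _ _ _ _ _ () })
  ; twoCycles = refl ; inv-parity = refl }

InvolutionWith-appendFixedPointʷ : ∀ {n c w} → InvolutionWith n c w → InvolutionWith (suc n) c (appendFixedPointʷ w)
InvolutionWith-appendFixedPointʷ {n} {c} {w} W = record
  { valid = is132AvoidingInvolution
  ; twoCycles = trans (cong (_+ (c + c)) fixedPoints-suc) (cong suc twoCycles)
  ; inv-parity = trans (cong (_% 2) inv-preserved) inv-parity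
  }
  where
  open InvolutionWith W
  open AppendFixedPointʷ w valid

InvolutionWith-pairUpʷ : ∀ {n c w} → c + c < n → InvolutionWith n c w → InvolutionWith (suc n) (suc c) (pairUpʷ w)
InvolutionWith-pairUpʷ {n} {c} {w} 2c<n W = record
  { valid = is132AvoidingInvolution
  ; twoCycles = trans (shift (fixedPoints (suc n) (at (pairUpʷ w))) c) (cong suc (trans (cong (_+ (c + c)) (sym fixedPoints-pred)) twoCycles))
  ; inv-parity = begin
      inv (pairUpʷ w) % 2          ≡⟨ inv-parity-flips ⟩
      suc (inv w) % 2              ≡⟨ %-distribˡ-+ 1 (inv w) 2 ⟩
      (1 + inv w % 2) % 2          ≡⟨ cong (λ x → (1 + x) % 2) inv-parity ⟩
      (1 + c % 2) % 2              ≡⟨ sym (%-distribˡ-+ 1 c 2) ⟩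
      suc c % 2                    ∎
  }
  where
  open ≡-Reasoning
  open InvolutionWith W
  open PairUpʷ w valid (hasFixedPoint 2c<n)
  shift : ∀ x c → x + (suc c + suc c) ≡ suc (suc x + (c + c))
  shift = solve-∀

∈-involutionsWith : ∀ n c w → w ∈ involutionsWith n c → InvolutionWith n c w
∈-involutionsWith zero    zero    w (here refl) = InvolutionWith-empty
∈-involutionsWith (suc n) zero    w w∈ with ∈-map⁻ appendFixedPointʷ w∈
... | v , v∈ , refl = InvolutionWith-appendFixedPointʷ (∈-involutionsWith n zero v v∈)
∈-involutionsWith (suc n) (suc c) w w∈ with ∈-++⁻ (map appendFixedPointʷ (involutionsWith n (suc c))) w∈
... | inj₁ w∈U with ∈-map⁻ appendFixedPointʷ w∈U
...   | v , v∈ , refl = InvolutionWith-appendFixedPointʷ (∈-involutionsWith n (suc c) v v∈)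
∈-involutionsWith (suc n) (suc c) w w∈ | inj₂ w∈D with c + c <ᵇ n | <ᵇ-reflects-< (c + c) n
... | true  | ofʸ 2c<n with ∈-map⁻ pairUpʷ w∈D
...   | v , v∈ , refl = InvolutionWith-pairUpʷ 2c<n (∈-involutionsWith n c v v∈)
∈-involutionsWith (suc n) (suc c) w _ | inj₂ () | false | _

involutionsWith-complete : ∀ n (w : Word n) → Is132AvoidingInvolution w → Σ ℕ λ c → c < suc n × w ∈ involutionsWith n c
involutionsWith-complete zero    [] _ = 0 , s≤s z≤n , here refl
involutionsWith-complete (suc n) w valid with at w n ≟ n
... | yes last-fixed with involutionsWith-complete n (initʷ w) (Initʷ.is132AvoidingInvolution w valid last-fixed)
...   | zero  , _      , v∈ = 0 , s≤s z≤n ,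
          subst (_∈ involutionsWith (suc n) 0) (Initʷ.appendFixedPointʷ-initʷ w valid last-fixed) (∈-map⁺ appendFixedPointʷ v∈)
...   | suc c , c<n+1 , v∈ = suc c , m<n⇒m<1+n c<n+1 ,
          subst (_∈ involutionsWith (suc n) (suc c)) (Initʷ.appendFixedPointʷ-initʷ w valid last-fixed) (∈-++⁺ˡ (∈-map⁺ appendFixedPointʷ v∈))
involutionsWith-complete (suc n) w valid | no last-not-fixed
  with involutionsWith-complete n (unpairʷ w) (Unpairʷ.is132AvoidingInvolution w valid last-not-fixed)
... | c , _ , v∈ = suc c , s≤s (s≤s (≤-trans (m≤m+n c c) (<⇒≤ 2c<n))) ,
                   subst (_∈ involutionsWith (suc n) (suc c)) (Unpairʷ.pairUpʷ-unpairʷ w valid last-not-fixed) ∈-pairUp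
  where
  2c<n : c + c < n
  2c<n = subst (c + c <_) (InvolutionWith.twoCycles (∈-involutionsWith n c _ v∈))
           (m<n+m (c + c) (HasFixedPoint⇒0<fixedPoints n _ (Unpairʷ.hasFixedPoint w valid last-not-fixed)))
  ∈-pairUp : pairUpʷ (unpairʷ w) ∈ involutionsWith (suc n) (suc c)
  ∈-pairUp with c + c <ᵇ n | <ᵇ-reflects-< (c + c) n
  ... | true  | _         = ∈-++⁺ʳ (map appendFixedPointʷ (involutionsWith n (suc c))) (∈-map⁺ pairUpʷ v∈)
  ... | false | ofⁿ 2c≮n = ⊥-elim (2c≮n 2c<n)

Unique-map-injectiveOn : ∀ {A B : Set} (f : A → B) {xs} → Unique xs →
  (∀ {x y} → x ∈ xs → y ∈ xs → f x ≡ f y → x ≡ y) → Unique (map f xs)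
Unique-map-injectiveOn f {[]}     []              _          = []
Unique-map-injectiveOn f {x ∷ xs} (x∉xs ∷ uniq) injectiveOn =
  Allₚ.map⁺ (All.tabulate (λ y∈ fx≡fy → All.lookup x∉xs y∈ (injectiveOn (here refl) (there y∈) fx≡fy)))
  ∷ Unique-map-injectiveOn f uniq (λ x∈ y∈ → injectiveOn (there x∈) (there y∈))

involutionsWith-unique : ∀ n c → Unique (involutionsWith n c)
involutionsWith-unique zero    zero    = All.[] ∷ []
involutionsWith-unique zero    (suc c) = []
involutionsWith-unique (suc n) zero    = Uniqueₚ.map⁺ (appendFixedPointʷ-injective _ _) (involutionsWith-unique n zero)
involutionsWith-unique (suc n) (suc c) with c + c <ᵇ n | <ᵇ-reflects-< (c + c) n
... | false | _ = Uniqueₚ.++⁺ (Uniqueₚ.map⁺ (appendFixedPointʷ-injective _ _) (involutionsWith-unique n (suc c))) [] (λ ())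
... | true  | ofʸ 2c<n = Uniqueₚ.++⁺ (Uniqueₚ.map⁺ (appendFixedPointʷ-injective _ _) (involutionsWith-unique n (suc c)))
                                    (Unique-map-injectiveOn pairUpʷ (involutionsWith-unique n c) pairUpʷ-injectiveOn) disjoint
  where
  fixedPoint : ∀ {v} → v ∈ involutionsWith n c → HasFixedPoint n (at v)
  fixedPoint v∈ = InvolutionWith.hasFixedPoint (∈-involutionsWith n c _ v∈) 2c<n
  valid : ∀ {v} → v ∈ involutionsWith n c → Is132AvoidingInvolution v
  valid v∈ = InvolutionWith.valid (∈-involutionsWith n c _ v∈)
  pairUpʷ-injectiveOn : ∀ {v w} → v ∈ involutionsWith n c → w ∈ involutionsWith n c → pairUpʷ v ≡ pairUpʷ w → v ≡ w
  pairUpʷ-injectiveOn {v} {w} v∈ w∈ Dv≡Dw = trans (sym (PairUpʷ.unpairʷ-pairUpʷ v (valid v∈) (fixedPoint v∈)))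
    (trans (cong unpairʷ Dv≡Dw) (PairUpʷ.unpairʷ-pairUpʷ w (valid w∈) (fixedPoint w∈)))
  disjoint : ∀ {u} → u ∈ map appendFixedPointʷ (involutionsWith n (suc c)) × u ∈ map pairUpʷ (involutionsWith n c) → ⊥
  disjoint (u∈U , u∈D) with ∈-map⁻ appendFixedPointʷ u∈U | ∈-map⁻ pairUpʷ u∈D
  ... | v , _ , refl | w , w∈ , Uv≡Dw = appendFixedPointʷ≢pairUpʷ v w (valid w∈) (fixedPoint w∈) Uv≡Dw

concatBelow : ∀ {n} → (ℕ → List (Word n)) → ℕ → List (Word n)
concatBelow h zero    = []
concatBelow h (suc m) = concatBelow h m ++ h m

∈-concatBelow⁻ : ∀ {n} (h : ℕ → List (Word n)) m {w} → w ∈ concatBelow h m → Σ ℕ λ c → c < m × w ∈ h c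
∈-concatBelow⁻ h (suc m) w∈ with ∈-++⁻ (concatBelow h m) w∈
... | inj₂ w∈hm = m , n<1+n m , w∈hm
... | inj₁ w∈<m with ∈-concatBelow⁻ h m w∈<m
...   | c , c<m , w∈hc = c , m<n⇒m<1+n c<m , w∈hc

∈-concatBelow⁺ : ∀ {n} (h : ℕ → List (Word n)) m {w} c → c < m → w ∈ h c → w ∈ concatBelow h m
∈-concatBelow⁺ h (suc m) c c<m+1 w∈hc with m≤n⇒m<n∨m≡n (≤-pred c<m+1)
... | inj₁ c<m  = ∈-++⁺ˡ (∈-concatBelow⁺ h m c c<m w∈hc)
... | inj₂ refl = ∈-++⁺ʳ (concatBelow h m) w∈hc

concatBelow-unique : ∀ n m → Unique (concatBelow (involutionsWith n) m)
concatBelow-unique n zero    = []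
concatBelow-unique n (suc m) = Uniqueₚ.++⁺ (concatBelow-unique n m) (involutionsWith-unique n m) disjoint
  where
  disjoint : ∀ {w} → w ∈ concatBelow (involutionsWith n) m × w ∈ involutionsWith n m → ⊥
  disjoint {w} (w∈<m , w∈m) with ∈-concatBelow⁻ (involutionsWith n) m w∈<m
  ... | c , c<m , w∈c = <⇒≢ c<m (double-injective c m (+-cancelˡ-≡ (fixedPoints n (at w)) (c + c) (m + m)
          (trans (InvolutionWith.twoCycles (∈-involutionsWith n c w w∈c)) (sym (InvolutionWith.twoCycles (∈-involutionsWith n m w w∈m))))))
    where
    double-injective : ∀ a b → a + a ≡ b + b → a ≡ b
    double-injective a b 2a≡2b = *-cancelˡ-≡ a b 2 (trans (cong (a +_) (+-identityʳ a)) (trans 2a≡2b (sym (cong (b +_) (+-identityʳ b)))))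

Unique-sameMembers⇒length≡ : ∀ {a} {A : Set a} {xs ys : List A} → Unique xs → Unique ys →
  (∀ {x} → x ∈ xs → x ∈ ys) → (∀ {x} → x ∈ ys → x ∈ xs) → length xs ≡ length ys
Unique-sameMembers⇒length≡ uxs uys xs⊆ys ys⊆xs = ↭-length (∼bag⇒↭ (unique∧set⇒bag uxs uys (mk⇔ xs⊆ys ys⊆xs)))

length-filter-involutions132 : ∀ n {p} {P : Pred (Word n) p} (P? : Decidable P) →
  length (filter P? (involutions132 n)) ≡ length (filter P? (concatBelow (involutionsWith n) (suc n)))
length-filter-involutions132 n P? = Unique-sameMembers⇒length≡
  (Uniqueₚ.filter⁺ P? (Uniqueₚ.filter⁺ is132AvoidingInvolution? (words-unique n n)))
  (Uniqueₚ.filter⁺ P? (concatBelow-unique n (suc n))) ⊆ ⊇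
  where
  ⊆ : ∀ {w} → w ∈ filter P? (involutions132 n) → w ∈ filter P? (concatBelow (involutionsWith n) (suc n))
  ⊆ {w} w∈ with ∈-filter⁻ P? {xs = involutions132 n} w∈
  ... | w∈involutions , Pw with ∈-filter⁻ is132AvoidingInvolution? {xs = words n n} w∈involutions
  ...   | _ , valid with involutionsWith-complete n w valid
  ...     | c , c<n+1 , w∈c = ∈-filter⁺ P? (∈-concatBelow⁺ (involutionsWith n) (suc n) c c<n+1 w∈c) Pw
  ⊇ : ∀ {w} → w ∈ filter P? (concatBelow (involutionsWith n) (suc n)) → w ∈ filter P? (involutions132 n)
  ⊇ {w} w∈ with ∈-filter⁻ P? {xs = concatBelow (involutionsWith n) (suc n)} w∈
  ... | w∈concat , Pw with ∈-concatBelow⁻ (involutionsWith n) (suc n) w∈concat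
  ...   | c , _ , w∈c =
    ∈-filter⁺ P? (∈-filter⁺ is132AvoidingInvolution? (∈-words n n w) (InvolutionWith.valid (∈-involutionsWith n c w w∈c))) Pw

length-filter-uniform : ∀ {A : Set} {p} {P : Pred A p} (P? : Decidable P) b e xs →
  (∀ {x} → x ∈ xs → P x ⇔ e ≡ b) → length (filter P? xs) ≡ ifSame b e (length xs)
length-filter-uniform P? b e xs P⇔e≡b with e Bool.≟ b
... | yes refl = trans (cong length (filter-all P? (All.tabulate (λ x∈ → Equivalence.from (P⇔e≡b x∈) refl)))) (sym (ifSame-refl b _))
... | no  e≢b  = trans (cong length (filter-none P? (All.tabulate (λ x∈ Px → e≢b (Equivalence.to (P⇔e≡b x∈) Px)))))
                      (sym (ifSame-≢ b e _ e≢b))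

length-filter-concatBelow : ∀ n {p} {P : Pred (Word n) p} (P? : Decidable P) b →
  (∀ c {w} → w ∈ involutionsWith n c → P w ⇔ evenᵇ c ≡ b) →
  ∀ m → length (filter P? (concatBelow (involutionsWith n) m)) ≡ paritySum b (ballot n) m
length-filter-concatBelow n P? b P⇔ zero    = refl
length-filter-concatBelow n P? b P⇔ (suc m) = begin
  length (filter P? (concatBelow (involutionsWith n) m ++ involutionsWith n m))
    ≡⟨ cong length (filter-++ P? (concatBelow (involutionsWith n) m) (involutionsWith n m)) ⟩
  length (filter P? (concatBelow (involutionsWith n) m) ++ filter P? (involutionsWith n m))
    ≡⟨ length-++ (filter P? (concatBelow (involutionsWith n) m)) ⟩
  length (filter P? (concatBelow (involutionsWith n) m)) + length (filter P? (involutionsWith n m))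
    ≡⟨ cong₂ _+_ (length-filter-concatBelow n P? b P⇔ m) (length-filter-uniform P? b (evenᵇ m) (involutionsWith n m) (P⇔ m)) ⟩
  paritySum b (ballot n) m + ifSame b (evenᵇ m) (length (involutionsWith n m))
    ≡⟨ cong (λ x → paritySum b (ballot n) m + ifSame b (evenᵇ m) x) (length-involutionsWith n m) ⟩
  paritySum b (ballot n) (suc m) ∎
  where open ≡-Reasoning

%2≡evenᵇ : ∀ c → c % 2 ≡ (if evenᵇ c then 0 else 1)
%2≡evenᵇ zero          = refl
%2≡evenᵇ (suc zero)    = refl
%2≡evenᵇ (suc (suc c)) = trans (%2≡evenᵇ c) (cong (if_then 0 else 1) (sym (not-involutive (evenᵇ c))))

bit≡0⇔ : ∀ {x} e → x ≡ (if e then 0 else 1) → x ≡ 0 ⇔ e ≡ true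
bit≡0⇔ true  x≡0 = mk⇔ (λ _ → refl) (λ _ → x≡0)
bit≡0⇔ false x≡1 = mk⇔ (λ x≡0 → contradiction (trans (sym x≡1) x≡0) λ ()) λ ()

bit≡1⇔ : ∀ {x} e → x ≡ (if e then 0 else 1) → x ≡ 1 ⇔ e ≡ false
bit≡1⇔ true  x≡0 = mk⇔ (λ x≡1 → contradiction (trans (sym x≡0) x≡1) λ ()) λ ()
bit≡1⇔ false x≡1 = mk⇔ (λ _ → refl) (λ _ → x≡1)

IsEven⇔evenᵇ : ∀ {n c w} → InvolutionWith n c w → IsEven w ⇔ evenᵇ c ≡ true
IsEven⇔evenᵇ {c = c} W = bit≡0⇔ (evenᵇ c) (trans (InvolutionWith.inv-parity W) (%2≡evenᵇ c))

IsOdd⇔evenᵇ : ∀ {n c w} → InvolutionWith n c w → IsOdd w ⇔ evenᵇ c ≡ false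
IsOdd⇔evenᵇ {c = c} W = bit≡1⇔ (evenᵇ c) (trans (InvolutionWith.inv-parity W) (%2≡evenᵇ c))

numEven≡paritySum : ∀ n → numEven n ≡ paritySum true (ballot n) (suc n)
numEven≡paritySum n = trans (length-filter-involutions132 n isEven?)
  (length-filter-concatBelow n isEven? true (λ c w∈ → IsEven⇔evenᵇ (∈-involutionsWith n c _ w∈)) (suc n))

numOdd≡paritySum : ∀ n → numOdd n ≡ paritySum false (ballot n) (suc n)
numOdd≡paritySum n = trans (length-filter-involutions132 n isOdd?)
  (length-filter-concatBelow n isOdd? false (λ c w∈ → IsOdd⇔evenᵇ (∈-involutionsWith n c _ w∈)) (suc n))

theorem2p3 : ∀ (n : ℕ) → 1 Data.Nat.≤ n →
    (numEven n ≡ (n ∸ 1) C (2 * ((n + 1) / 4))) × (numOdd n ≡ (n ∸ 1) C (1 + 2 * ((n ∸ 2) / 4)))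
theorem2p3 n 1≤n =
  trans (numEven≡paritySum n) (proj₁ (ballot-parity-formula n 1≤n)) ,
  trans (numOdd≡paritySum n) (proj₂ (ballot-parity-formula n 1≤n))
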